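{- Let $n=p_1p_2p_3$ with $p_1,p_2,p_3$ three distinct primes, $\gcd(n,6)=1$ and $n>1000$. Let $G$ be cyclic of order $n$ and $g\in G$ with $\mathrm{ord}(g)=n$. Let $a,b,c$ be integers with $1+c=a+b$ and $1<c<\frac n2<n-b\le n-a<n-1$, and suppose $S=(g)\cdot(cg)\cdot((n-b)g)\cdot((n-a)g)$ is a reduced minimal zero-sum sequence over $G$. Suppose that, for a suitable labeling of the primes, one of the following holds: (A2) $\{\gcd(c,n),\gcd(b,n),\gcd(a,n)\}=\{p_1,p_2,p_1p_2\}$; (A3) $\gcd(c+1,n)=p_1p_2$, $\gcd(b-1,n)=p_1p_3$, $\gcd(a-1,n)=p_2p_3$; (A4) $\gcd(c,n)=p_1p_2$, $\gcd(b,n)=p_1p_3$, $\gcd(a,n)=p_2p_3$. Then $\mathrm{ind}(S)=1$.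
   Context: A sequence over $G$ is a finite unordered list of elements of $G$ with repetition allowed. It is zero-sum if its terms sum to $0$, and minimal zero-sum if it is zero-sum and no proper nonempty subsequence is zero-sum. $S$ is reduced if for every prime $p\mid n$ the sequence obtained by multiplying every term of $S$ by $p$, namely $(pg)\cdot(pcg)\cdot(p(n-b)g)\cdot(p(n-a)g)$, is not a minimal zero-sum sequence. For a generator $h$ of $G$, write $S=(m_1h)\cdots(m_4h)$ with $m_j\in[1,n]$ and set $\|S\|_h=(m_1+\cdots+m_4)/n$; $\mathrm{ind}(S)=\min\{\|S\|_h:\langle h\rangle=G\}$. -}

module Defs where

open import Data.Nat using (ℕ; zero; suc; _+_; _*_; _∸_; _≤_; _<_)
open import Data.Nat.GCD using (gcd)
open import Data.Nat.Primality using (Prime)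
open import Data.Integer as ℤ using (ℤ; +_)
import Data.Integer.Divisibility as ℤD
open import Data.List using (List; []; _∷_; map; length)
open import Data.Nat.ListAction using (sum)
open import Data.List.Relation.Binary.Sublist.Propositional using (_⊆_)
open import Data.Product using (Σ; ∃; ∃-syntax; _×_; _,_)
open import Data.Sum using (_⊎_)
open import Relation.Binary.PropositionalEquality using (_≡_; _≢_)
open import Relation.Nullary using (¬_)

-- The cyclic group G of order n is modelled as ℤ/nℤ; an element is
-- represented by a natural number, and two naturals denote the same
-- element iff they are congruent modulo n.
_≡[_]_ : ℕ → ℕ → ℕ → Set
x ≡[ n ] y = (+ n) ℤD.∣ ((+ x) ℤ.- (+ y))

HasOrder : ℕ → ℕ → ℕ → Set
HasOrder n g k = (0 < k) × ((k * g) ≡[ n ] 0) × (∀ j → 0 < j → j < k → ¬ ((j * g) ≡[ n ] 0))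

Generates : ℕ → ℕ → Set
Generates n h = ∀ t → ∃[ m ] ((m * h) ≡[ n ] t)

-- A sequence over G: a finite list of elements (order irrelevant for
-- all notions below).
ZeroSum : ℕ → List ℕ → Set
ZeroSum n S = sum S ≡[ n ] 0

MinimalZeroSum : ℕ → List ℕ → Set
MinimalZeroSum n S =
  ZeroSum n S ×
  (∀ (T : List ℕ) → T ⊆ S → 0 < length T → length T < length S → ¬ ZeroSum n T)

Reduced : ℕ → List ℕ → Set
Reduced n S = ∀ p → Prime p → Data.Nat.Divisibility._∣_ p n → ¬ MinimalZeroSum n (map (p *_) S)
  where import Data.Nat.Divisibility

data Coeffs (n h : ℕ) : List ℕ → List ℕ → Set where
  []  : Coeffs n h [] []
  _∷_ : ∀ {t m S M} → (1 ≤ m × m ≤ n × (m * h) ≡[ n ] t) →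
        Coeffs n h S M → Coeffs n h (t ∷ S) (m ∷ M)

-- n · ‖S‖_h = s  (the h-norm, scaled by n so that it is a natural number).
ScaledNorm : ℕ → ℕ → List ℕ → ℕ → Set
ScaledNorm n h S s = ∃[ M ] (Coeffs n h S M × sum M ≡ s)

-- ind(S) = 1 :  min over generators h of ‖S‖_h equals 1, i.e.
-- some generator has ‖S‖_h = 1 and every generator has ‖S‖_h ≥ 1.
IndexOne : ℕ → List ℕ → Set
IndexOne n S =
  (∃[ h ] (Generates n h × ScaledNorm n h S n)) ×
  (∀ h s → Generates n h → ScaledNorm n h S s → n ≤ s)

SetEq3 : ℕ → ℕ → ℕ → ℕ → ℕ → ℕ → Set
SetEq3 x y z u v w =
  (∀ e → e ≡ x ⊎ e ≡ y ⊎ e ≡ z → e ≡ u ⊎ e ≡ v ⊎ e ≡ w) ×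
  (∀ e → e ≡ u ⊎ e ≡ v ⊎ e ≡ w → e ≡ x ⊎ e ≡ y ⊎ e ≡ z)

CaseA2 CaseA3 CaseA4 : ℕ → ℕ → ℕ → ℕ → ℕ → ℕ → ℕ → Set
CaseA2 n a b c q₁ q₂ q₃ = SetEq3 (gcd c n) (gcd b n) (gcd a n) q₁ q₂ (q₁ * q₂)
CaseA3 n a b c q₁ q₂ q₃ =
  (gcd (c + 1) n ≡ q₁ * q₂) × (gcd (b ∸ 1) n ≡ q₁ * q₃) × (gcd (a ∸ 1) n ≡ q₂ * q₃)
CaseA4 n a b c q₁ q₂ q₃ =
  (gcd c n ≡ q₁ * q₂) × (gcd b n ≡ q₁ * q₃) × (gcd a n ≡ q₂ * q₃)

theSeq : ℕ → ℕ → ℕ → ℕ → ℕ → List ℕ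
theSeq n a b c g = g ∷ (c * g) ∷ ((n ∸ b) * g) ∷ ((n ∸ a) * g) ∷ []

module Submission where

-- ind(S) ≥ 1 holds for any zero-sum sequence: with respect to every generator h the
-- coefficients of S add up to a positive multiple of n.  For ind(S) ≤ 1 it suffices to
-- exhibit a unit u such that the reductions into [1,n] of u, uc, u(n-b), u(n-a) add up
-- to exactly n; then h = u⁻¹g has ‖S‖_h = 1.  Such data is a Certificate.  Its
-- congruences are ring identities in ℤ (an IntegerCertificate), and u is a unit because
-- it is congruent to one of ±1, ±2, 3 modulo each prime qᵢ > 3.

open import Defs
open import Data.Nat using (ℕ; _+_; _*_; _∸_; _≤_; _<_)
open import Data.Nat.GCD using (gcd)
open import Data.Nat.Primality using (Prime)
open import Data.Product using (∃-syntax; _×_)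
open import Data.Sum using (_⊎_)
open import Relation.Binary.PropositionalEquality using (_≡_; _≢_)

open import Data.Nat as ℕ using (zero; suc; z≤n; s≤s)
import Data.Nat.Properties as ℕP
open import Data.Nat.Divisibility as ℕ∣ using (_∣_; divides)
open import Data.Nat.Coprimality as Coprimality using (Coprime)
open import Data.Nat.GCD using (module Bézout; gcd-greatest; gcd[m,n]∣m)
open import Data.Nat.Primality
  using (euclidsLemma; prime⇒irreducible; prime⇒nonTrivial; prime⇒nonZero)
open import Data.Nat.ListAction using (sum)
import Data.Nat.Tactic.RingSolver as ℕSolver
open import Data.Integer as ℤ using (ℤ; +_)
import Data.Integer.Properties as ℤP
open import Data.Integer.Divisibility.Signed as ℤ∣ using () renaming (_∣_ to _∣ᶻ_)
open import Data.Integer.Tactic.RingSolver using (solve-∀)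
open import Data.List using ([]; _∷_; map; length)
open import Data.List.Relation.Binary.Sublist.Propositional using (_⊆_)
open import Data.List.Relation.Binary.Sublist.Heterogeneous using ([]; _∷_; _∷ʳ_)
open import Data.Product using (_,_; proj₁; proj₂)
open import Data.Sum using (inj₁; inj₂)
import Data.Sum as Sum
open import Data.Empty using (⊥-elim)
open import Function using (_∘_)
open import Relation.Binary.Bundles using (Setoid)
import Relation.Binary.Reasoning.Setoid as SetoidReasoning
open import Relation.Binary.PropositionalEquality
  using (refl; sym; trans; cong; cong₂; subst; subst₂; module ≡-Reasoning)
open import Relation.Nullary using (¬_; Dec)
open import Relation.Nullary.Decidable using (True; toWitness; yes; no; _⊎-dec_)

infix 4 _≈_mod_

record _≈_mod_ (x y N : ℤ) : Set where
  constructor divides-difference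
  field difference : N ∣ᶻ (x ℤ.- y)

module _ {N : ℤ} where

  ≈mod-reflexive : ∀ {x y} → x ≡ y → x ≈ y mod N
  ≈mod-reflexive {x} refl = divides-difference (ℤ∣.divides (+ 0) (ℤP.+-inverseʳ x))

  ≈mod-sym : ∀ {x y} → x ≈ y mod N → y ≈ x mod N
  ≈mod-sym {x} {y} (divides-difference d) =
    divides-difference (subst (N ∣ᶻ_) (lemma x y) (ℤ∣.∣m⇒∣-m d))
    where lemma : ∀ x y → ℤ.- (x ℤ.- y) ≡ y ℤ.- x
          lemma = solve-∀

  ≈mod-trans : ∀ {x y z} → x ≈ y mod N → y ≈ z mod N → x ≈ z mod N
  ≈mod-trans {x} {y} {z} (divides-difference d) (divides-difference e) =
    divides-difference (subst (N ∣ᶻ_) (lemma x y z) (ℤ∣.∣m∣n⇒∣m+n d e))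
    where lemma : ∀ x y z → (x ℤ.- y) ℤ.+ (y ℤ.- z) ≡ x ℤ.- z
          lemma = solve-∀

  ≈mod-+ : ∀ {x y x′ y′} → x ≈ y mod N → x′ ≈ y′ mod N → x ℤ.+ x′ ≈ y ℤ.+ y′ mod N
  ≈mod-+ {x} {y} {x′} {y′} (divides-difference d) (divides-difference e) =
    divides-difference (subst (N ∣ᶻ_) (lemma x y x′ y′) (ℤ∣.∣m∣n⇒∣m+n d e))
    where lemma : ∀ x y x′ y′ → (x ℤ.- y) ℤ.+ (x′ ℤ.- y′) ≡ x ℤ.+ x′ ℤ.- (y ℤ.+ y′)
          lemma = solve-∀

  ≈mod-* : ∀ {x y x′ y′} → x ≈ y mod N → x′ ≈ y′ mod N → x ℤ.* x′ ≈ y ℤ.* y′ mod N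
  ≈mod-* {x} {y} {x′} {y′} (divides-difference d) (divides-difference e) =
    divides-difference (subst (N ∣ᶻ_) (lemma x y x′ y′)
                                 (ℤ∣.∣m∣n⇒∣m+n (ℤ∣.∣n⇒∣m*n x′ d) (ℤ∣.∣n⇒∣m*n y e)))
    where lemma : ∀ x y x′ y′ →
                  x′ ℤ.* (x ℤ.- y) ℤ.+ y ℤ.* (x′ ℤ.- y′) ≡ x ℤ.* x′ ℤ.- y ℤ.* y′
          lemma = solve-∀

≈mod-setoid : ℤ → Setoid _ _
≈mod-setoid N = record
  { Carrier       = ℤ
  ; _≈_           = λ x y → x ≈ y mod N
  ; isEquivalence = record { refl = ≈mod-reflexive refl ; sym = ≈mod-sym ; trans = ≈mod-trans }
  }

≈mod-*ˡ : ∀ {N} k {x y} → x ≈ y mod N → k ℤ.* x ≈ k ℤ.* y mod N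
≈mod-*ˡ k = ≈mod-* (≈mod-reflexive {x = k} refl)

module ≈mod-Reasoning (N : ℤ) = SetoidReasoning (≈mod-setoid N)

fromℕ-cong : ∀ {n x y} → x ≡[ n ] y → + x ≈ + y mod + n
fromℕ-cong {n} {x} {y} d = divides-difference (ℤ∣.∣ᵤ⇒∣ {+ n} {+ x ℤ.- + y} d)

toℕ-cong : ∀ {n x y} → + x ≈ + y mod + n → x ≡[ n ] y
toℕ-cong {n} {x} {y} (divides-difference d) = ℤ∣.∣⇒∣ᵤ {+ n} {+ x ℤ.- + y} d

pos-∸ : ∀ {m k} → k ≤ m → + (m ∸ k) ≡ + m ℤ.- + k
pos-∸ {m} {k} k≤m = sym (trans (ℤP.m-n≡m⊖n m k) (ℤP.⊖-≥ k≤m))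

≡[]0⇒∣ : ∀ {n x} → x ≡[ n ] 0 → n ∣ x
≡[]0⇒∣ {n} {x} d = subst (n ∣_) (ℕP.+-identityʳ x) d

∣⇒≡[]0 : ∀ {n x} → n ∣ x → x ≡[ n ] 0
∣⇒≡[]0 {n} {x} d = subst (n ∣_) (sym (ℕP.+-identityʳ x)) d

fromℕ-cong-* : ∀ {n} x y {z} → (x * y) ≡[ n ] z → + x ℤ.* + y ≈ + z mod + n
fromℕ-cong-* {n} x y {z} e = subst (_≈ + z mod + n) (ℤP.pos-* x y) (fromℕ-cong e)

unit-cancel : ∀ {n k h} x → + k ℤ.* + h ≈ + 1 mod + n → + x ℤ.* + h ≈ + 0 mod + n → n ∣ x
unit-cancel {n} {k} {h} x kh≈1 xh≈0 = ≡[]0⇒∣ (toℕ-cong (begin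
  + x                        ≡⟨ ℤP.*-identityʳ (+ x) ⟨
  + x ℤ.* + 1                ≈⟨ ≈mod-*ˡ (+ x) (≈mod-sym kh≈1) ⟩
  + x ℤ.* (+ k ℤ.* + h)      ≡⟨ swap (+ x) (+ k) (+ h) ⟩
  + k ℤ.* (+ x ℤ.* + h)      ≈⟨ ≈mod-*ˡ (+ k) xh≈0 ⟩
  + k ℤ.* + 0                ≡⟨ ℤP.*-zeroʳ (+ k) ⟩
  + 0                        ∎))
  where
  open ≈mod-Reasoning (+ n)
  swap : ∀ x y z → x ℤ.* (y ℤ.* z) ≡ y ℤ.* (x ℤ.* z)
  swap = solve-∀

-- The lower bound: every norm of a zero-sum sequence is at least 1.

coeffs-sum : ∀ {n h S M} → Coeffs n h S M → + (sum M) ℤ.* + h ≈ + (sum S) mod + n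
coeffs-sum [] = ≈mod-reflexive refl
coeffs-sum {n} {h} (_∷_ {t} {m} {S} {M} (_ , _ , mh≡t) cs) = begin
  + (m + sum M) ℤ.* + h               ≡⟨ cong (ℤ._* + h) (ℤP.pos-+ m (sum M)) ⟩
  (+ m ℤ.+ + sum M) ℤ.* + h           ≡⟨ ℤP.*-distribʳ-+ (+ h) (+ m) (+ sum M) ⟩
  + m ℤ.* + h ℤ.+ + sum M ℤ.* + h     ≈⟨ ≈mod-+ (fromℕ-cong-* m h mh≡t) (coeffs-sum cs) ⟩
  + t ℤ.+ + sum S                     ≡⟨ ℤP.pos-+ t (sum S) ⟨
  + (t + sum S)                       ∎
  where
  open ≈mod-Reasoning (+ n)

-- With respect to any generator h, the coefficients of a nonempty zero-sum
-- sequence add up to a positive multiple of n (as h is invertible); hence ‖S‖_h ≥ 1.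
norm-lowerBound : ∀ {n h t S s} → ZeroSum n (t ∷ S) → Generates n h →
                  ScaledNorm n h (t ∷ S) s → n ≤ s
norm-lowerBound {n} {h} {t} {S} zs gen (m ∷ M , cs@((1≤m , _) ∷ _) , refl)
  with gen 1
... | k , kh≡1 = ℕ∣.∣⇒≤ ⦃ ℕ.>-nonZero positive ⦄
                   (unit-cancel {n} {k} {h} (m + sum M) (fromℕ-cong-* k h kh≡1)
                                (≈mod-trans (coeffs-sum cs) (fromℕ-cong zs)))
  where
  positive : 0 < m + sum M
  positive = ℕP.≤-trans 1≤m (ℕP.m≤m+n m (sum M))

-- An element of order n is coprime to n: a common divisor d ≥ 2 of g and n
-- would give (n/d)·g ≡ 0 with 0 < n/d < n.
order⇒coprime : ∀ {n g} → HasOrder n g n → Coprime g n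
order⇒coprime {n} {g} (0<n , _ , noSmallerOrder) {d} (divides k g≡kd , d∣n) with d
... | zero          = ⊥-elim (ℕP.<-irrefl (sym n≡0) 0<n)
  where n≡0 : n ≡ 0
        n≡0 = trans (ℕ∣.m∣n⇒n≡quotient*m d∣n) (ℕP.*-zeroʳ (ℕ∣.quotient d∣n))
... | suc zero      = refl
... | suc (suc d′)  = ⊥-elim (noSmallerOrder j 0<j j<n jg≡0)
  where
  instance
    n≢0 : ℕ.NonZero n
    n≢0 = ℕ.>-nonZero 0<n
  j : ℕ
  j = ℕ∣.quotient d∣n
  0<j : 0 < j
  0<j = ℕ.>-nonZero⁻¹ j ⦃ ℕ∣.quotient≢0 d∣n ⦄
  j<n : j < n
  j<n = ℕ∣.quotient-< d∣n
  jg≡kn : j * g ≡ k * n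
  jg≡kn = begin
    j * g                  ≡⟨ cong (j *_) g≡kd ⟩
    j * (k * suc (suc d′)) ≡⟨ ℕP.*-comm j _ ⟩
    k * suc (suc d′) * j   ≡⟨ ℕP.*-assoc k _ j ⟩
    k * (suc (suc d′) * j) ≡⟨ cong (k *_) (ℕP.*-comm _ j) ⟩
    k * (j * suc (suc d′)) ≡⟨ cong (k *_) (ℕ∣.m∣n⇒n≡quotient*m d∣n) ⟨
    k * n                  ∎
    where open ≡-Reasoning
  jg≡0 : (j * g) ≡[ n ] 0
  jg≡0 = ∣⇒≡[]0 (subst (n ∣_) (sym jg≡kn) (ℕ∣.n∣m*n k))

cast-Bézout : ∀ {d x y m n} → d + y * n ≡ x * m → + d ℤ.+ + y ℤ.* + n ≡ + x ℤ.* + m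
cast-Bézout {d} {x} {y} {m} {n} eq = begin
  + d ℤ.+ + y ℤ.* + n   ≡⟨ cong (λ z → + d ℤ.+ z) (ℤP.pos-* y n) ⟨
  + d ℤ.+ + (y * n)     ≡⟨ ℤP.pos-+ d (y * n) ⟨
  + (d + y * n)         ≡⟨ cong +_ eq ⟩
  + (x * m)             ≡⟨ ℤP.pos-* x m ⟩
  + x ℤ.* + m           ∎
  where open ≡-Reasoning

inverse : ∀ {n u} → 0 < n → Coprime u n → ∃[ v ] (+ v ℤ.* + u ≈ + 1 mod + n)
inverse {n} {u} 0<n coprime with Coprimality.coprime-Bézout coprime
... | Bézout.+- x y 1+yn≡xu = x , divides-difference (ℤ∣.divides (+ y) xu-1≡yn)
  where
  xu-1≡yn : + x ℤ.* + u ℤ.- + 1 ≡ + y ℤ.* + n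
  xu-1≡yn = begin
    + x ℤ.* + u ℤ.- + 1           ≡⟨ cong (ℤ._- + 1) (cast-Bézout {1} {x} {y} {u} {n} 1+yn≡xu) ⟨
    + 1 ℤ.+ + y ℤ.* + n ℤ.- + 1   ≡⟨ lemma (+ y ℤ.* + n) ⟩
    + y ℤ.* + n                   ∎
    where open ≡-Reasoning
          lemma : ∀ z → + 1 ℤ.+ z ℤ.- + 1 ≡ z
          lemma = solve-∀
... | Bézout.-+ x y 1+xu≡yn with n | 0<n
...   | suc n′ | _ = x * n′ , (begin
  + (x * n′) ℤ.* + u                ≡⟨ cong (ℤ._* + u) (ℤP.pos-* x n′) ⟩
  + x ℤ.* + n′ ℤ.* + u              ≡⟨ rearrange (+ x) (+ n′) (+ u) ⟩
  + n′ ℤ.* (+ x ℤ.* + u)            ≈⟨ ≈mod-*ˡ (+ n′) xu≈-1 ⟩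
  + n′ ℤ.* ℤ.- + 1                  ≈⟨ ≈mod-sym n≈0 ⟩
  + 1                               ∎)
  where
  open ≈mod-Reasoning (+ suc n′)
  rearrange : ∀ x n u → x ℤ.* n ℤ.* u ≡ n ℤ.* (x ℤ.* u)
  rearrange = solve-∀
  xu≈-1 : + x ℤ.* + u ≈ ℤ.- + 1 mod + suc n′
  xu≈-1 = divides-difference (ℤ∣.divides (+ y)
            (trans (lemma (+ x ℤ.* + u)) (cast-Bézout {1} {y} {x} {suc n′} {u} 1+xu≡yn)))
    where lemma : ∀ z → z ℤ.- ℤ.- + 1 ≡ + 1 ℤ.+ z
          lemma = solve-∀
  n≈0 : + 1 ≈ + n′ ℤ.* ℤ.- + 1 mod + suc n′
  n≈0 = divides-difference
          (subst (+ suc n′ ∣ᶻ_) (sym (trans (lemma (+ n′)) (sym (ℤP.pos-+ 1 n′)))) ℤ∣.∣-refl)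
    where lemma : ∀ z → + 1 ℤ.- z ℤ.* ℤ.- + 1 ≡ + 1 ℤ.+ z
          lemma = solve-∀

coprime⇒pos : ∀ {u n} → 1 < n → Coprime u n → 0 < u
coprime⇒pos {zero}  {n} 1<n coprime = ⊥-elim (ℕP.<-irrefl (sym (coprime (n ℕ∣.∣0 , ℕ∣.∣-refl))) 1<n)
coprime⇒pos {suc u} _   _       = s≤s z≤n

-- The upper bound: certificates for ind(S) = 1.

-- Writing g = u·h for a generator h, the coefficients of S = g·(cg)·((n-b)g)·((n-a)g)
-- with respect to h are u and the reductions m₂, m₃, m₄ of uc, u(n-b), u(n-a)
-- into [1,n].  A certificate is such data with u + m₂ + m₃ + m₄ = n, i.e. ‖S‖_h = 1.
record Certificate (n a b : ℕ) : Set where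
  field
    u m₂ m₃ m₄ : ℕ
    unit       : Coprime u n
    m₂-pos     : 0 < m₂
    m₃-pos     : 0 < m₃
    m₄-pos     : 0 < m₄
    total      : + u ℤ.+ (+ m₂ ℤ.+ (+ m₃ ℤ.+ + m₄)) ≡ + n
    coeff₂     : + m₂ ≈ + u ℤ.* (+ a ℤ.+ + b ℤ.- + 1) mod + n
    coeff₃     : + m₃ ≈ + u ℤ.* (+ n ℤ.- + b) mod + n
    coeff₄     : + m₄ ≈ + u ℤ.* (+ n ℤ.- + a) mod + n

-- S is symmetric in a and b, and so are its certificates.
swap-certificate : ∀ {n a b} → Certificate n b a → Certificate n a b
swap-certificate {n} {a} {b} cert = record
  { u = u ; m₂ = m₂ ; m₃ = m₄ ; m₄ = m₃ ; unit = unit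
  ; m₂-pos = m₂-pos ; m₃-pos = m₄-pos ; m₄-pos = m₃-pos
  ; total  = trans (swap₃₄ (+ u) (+ m₂) (+ m₄) (+ m₃)) total
  ; coeff₂ = subst (λ e → + m₂ ≈ + u ℤ.* (e ℤ.- + 1) mod + n) (ℤP.+-comm (+ b) (+ a)) coeff₂
  ; coeff₃ = coeff₄
  ; coeff₄ = coeff₃
  }
  where
  open Certificate cert
  swap₃₄ : ∀ x y z w → x ℤ.+ (y ℤ.+ (z ℤ.+ w)) ≡ x ℤ.+ (y ℤ.+ (w ℤ.+ z))
  swap₃₄ = solve-∀

coefficient : ∀ {n u v g m t} (e : ℤ) → + v ℤ.* + u ≈ + 1 mod + n →
              + m ≈ + u ℤ.* e mod + n → + t ≡ e ℤ.* + g → (m * (v * g)) ≡[ n ] t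
coefficient {n} {u} {v} {g} {m} {t} e vu≈1 m≈ue t≡eg = toℕ-cong (begin
  + (m * (v * g))                  ≡⟨ ℤP.pos-* m (v * g) ⟩
  + m ℤ.* + (v * g)                ≡⟨ cong (λ z → + m ℤ.* z) (ℤP.pos-* v g) ⟩
  + m ℤ.* (+ v ℤ.* + g)            ≈⟨ ≈mod-* m≈ue (≈mod-reflexive refl) ⟩
  + u ℤ.* e ℤ.* (+ v ℤ.* + g)      ≡⟨ rearrange (+ u) e (+ v) (+ g) ⟩
  (+ v ℤ.* + u) ℤ.* (e ℤ.* + g)    ≈⟨ ≈mod-* vu≈1 (≈mod-reflexive refl) ⟩
  + 1 ℤ.* (e ℤ.* + g)              ≡⟨ ℤP.*-identityˡ (e ℤ.* + g) ⟩
  e ℤ.* + g                        ≡⟨ t≡eg ⟨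
  + t                              ∎)
  where
  open ≈mod-Reasoning (+ n)
  rearrange : ∀ u e v g → u ℤ.* e ℤ.* (v ℤ.* g) ≡ (v ℤ.* u) ℤ.* (e ℤ.* g)
  rearrange = solve-∀

unit*generator : ∀ {n u v w g} → + v ℤ.* + u ≈ + 1 mod + n → + w ℤ.* + g ≈ + 1 mod + n →
                 Generates n (v * g)
unit*generator {n} {u} {v} {w} {g} vu≈1 wg≈1 t = t * (w * u) , toℕ-cong (begin
  + (t * (w * u) * (v * g))                          ≡⟨ cast ⟩
  + t ℤ.* (+ w ℤ.* + u) ℤ.* (+ v ℤ.* + g)            ≡⟨ rearrange (+ t) (+ w) (+ u) (+ v) (+ g) ⟩
  + t ℤ.* ((+ w ℤ.* + g) ℤ.* (+ v ℤ.* + u))          ≈⟨ ≈mod-*ˡ (+ t) (≈mod-* wg≈1 vu≈1) ⟩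
  + t ℤ.* (+ 1 ℤ.* + 1)                              ≡⟨ ℤP.*-identityʳ (+ t) ⟩
  + t                                                ∎)
  where
  open ≈mod-Reasoning (+ n)
  rearrange : ∀ t w u v g → t ℤ.* (w ℤ.* u) ℤ.* (v ℤ.* g) ≡ t ℤ.* ((w ℤ.* g) ℤ.* (v ℤ.* u))
  rearrange = solve-∀
  cast : + (t * (w * u) * (v * g)) ≡ + t ℤ.* (+ w ℤ.* + u) ℤ.* (+ v ℤ.* + g)
  cast = trans (ℤP.pos-* (t * (w * u)) (v * g))
               (cong₂ ℤ._*_ (trans (ℤP.pos-* t (w * u)) (cong (λ z → + t ℤ.* z) (ℤP.pos-* w u)))
                            (ℤP.pos-* v g))

summands≤ : ∀ {n x y z w} → x + (y + (z + w)) ≡ n → x ≤ n × y ≤ n × z ≤ n × w ≤ n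
summands≤ {n} {x} {y} {z} {w} refl =
  ℕP.m≤m+n x _ ,
  ℕP.≤-trans (ℕP.m≤m+n y _) (ℕP.m≤n+m _ x) ,
  ℕP.≤-trans (ℕP.m≤m+n z w) (ℕP.≤-trans (ℕP.m≤n+m _ y) (ℕP.m≤n+m _ x)) ,
  ℕP.≤-trans (ℕP.m≤n+m w z) (ℕP.≤-trans (ℕP.m≤n+m _ y) (ℕP.m≤n+m _ x))

pos-c : ∀ {a b c} → 1 + c ≡ a + b → + c ≡ + a ℤ.+ + b ℤ.- + 1
pos-c {a} {b} {c} c≡ = begin
  + c                       ≡⟨ lemma (+ c) ⟩
  + (1 + c) ℤ.- + 1         ≡⟨ cong (λ z → + z ℤ.- + 1) c≡ ⟩
  + (a + b) ℤ.- + 1         ≡⟨ cong (ℤ._- + 1) (ℤP.pos-+ a b) ⟩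
  + a ℤ.+ + b ℤ.- + 1       ∎
  where open ≡-Reasoning
        lemma : ∀ z → z ≡ + 1 ℤ.+ z ℤ.- + 1
        lemma = solve-∀

certificate⇒indexOne : ∀ {n a b c g} → 1 < n → HasOrder n g n → 1 + c ≡ a + b →
  a ≤ n → b ≤ n → ZeroSum n (theSeq n a b c g) → Certificate n a b → IndexOne n (theSeq n a b c g)
certificate⇒indexOne {n} {a} {b} {c} {g} 1<n order c≡ a≤n b≤n zeroSum cert
  with inverse (ℕP.<⇒≤ 1<n) (Certificate.unit cert) | inverse (ℕP.<⇒≤ 1<n) (order⇒coprime order)
... | v , vu≈1 | w , wg≈1 =
  (v * g , unit*generator {n} {u} {v} {w} {g} vu≈1 wg≈1 , (u ∷ m₂ ∷ m₃ ∷ m₄ ∷ []) , coeffs , sum≡n) ,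
  λ h s generator norm → norm-lowerBound zeroSum generator norm
  where
  open Certificate cert
  sumℕ : u + (m₂ + (m₃ + m₄)) ≡ n
  sumℕ = ℤP.+-injective (begin
    + (u + (m₂ + (m₃ + m₄)))            ≡⟨ ℤP.pos-+ u _ ⟩
    + u ℤ.+ + (m₂ + (m₃ + m₄))          ≡⟨ cong (λ z → + u ℤ.+ z) (ℤP.pos-+ m₂ _) ⟩
    + u ℤ.+ (+ m₂ ℤ.+ + (m₃ + m₄))      ≡⟨ cong (λ z → + u ℤ.+ (+ m₂ ℤ.+ z)) (ℤP.pos-+ m₃ m₄) ⟩
    + u ℤ.+ (+ m₂ ℤ.+ (+ m₃ ℤ.+ + m₄))  ≡⟨ total ⟩
    + n                                 ∎)
    where open ≡-Reasoning
  sum≡n : u + (m₂ + (m₃ + (m₄ + 0))) ≡ n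
  sum≡n = trans (cong (λ z → u + (m₂ + (m₃ + z))) (ℕP.+-identityʳ m₄)) sumℕ
  bounds : u ≤ n × m₂ ≤ n × m₃ ≤ n × m₄ ≤ n
  bounds = summands≤ sumℕ
  coefficient′ : ∀ {m t} e → + m ≈ + u ℤ.* e mod + n → + t ≡ e ℤ.* + g → (m * (v * g)) ≡[ n ] t
  coefficient′ {m} {t} e = coefficient {n} {u} {v} {g} {m} {t} e vu≈1
  coeffs : Coeffs n (v * g) (theSeq n a b c g) (u ∷ m₂ ∷ m₃ ∷ m₄ ∷ [])
  coeffs =
    (coprime⇒pos 1<n unit , proj₁ bounds ,
      coefficient′ (+ 1) (≈mod-reflexive (sym (ℤP.*-identityʳ (+ u)))) (sym (ℤP.*-identityˡ (+ g)))) ∷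
    (m₂-pos , proj₁ (proj₂ bounds) ,
      coefficient′ _ coeff₂ (trans (ℤP.pos-* c g) (cong (ℤ._* + g) (pos-c {a} {b} {c} c≡)))) ∷
    (m₃-pos , proj₁ (proj₂ (proj₂ bounds)) ,
      coefficient′ _ coeff₃ (trans (ℤP.pos-* (n ∸ b) g) (cong (ℤ._* + g) (pos-∸ b≤n)))) ∷
    (m₄-pos , proj₂ (proj₂ (proj₂ bounds)) ,
      coefficient′ _ coeff₄ (trans (ℤP.pos-* (n ∸ a) g) (cong (ℤ._* + g) (pos-∸ a≤n)))) ∷ []

record Factorisation (n q₁ q₂ q₃ : ℕ) : Set where
  field
    prime₁ : Prime q₁
    prime₂ : Prime q₂
    prime₃ : Prime q₃
    q₁≢q₂  : q₁ ≢ q₂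
    q₁≢q₃  : q₁ ≢ q₃
    q₂≢q₃  : q₂ ≢ q₃
    n≡     : n ≡ q₁ * q₂ * q₃
    3<q₁   : 3 < q₁
    3<q₂   : 3 < q₂
    3<q₃   : 3 < q₃

prime>1 : ∀ {p} → Prime p → 1 < p
prime>1 {p} p-prime = ℕ.nonTrivial⇒n>1 p ⦃ prime⇒nonTrivial p-prime ⦄

prime∤6⇒3<p : ∀ {p} → Prime p → ¬ p ∣ 6 → 3 < p
prime∤6⇒3<p {p} p-prime p∤6 with p | prime>1 p-prime
... | suc zero                | s≤s ()
... | suc (suc zero)          | _ = ⊥-elim (p∤6 (divides 3 refl))
... | suc (suc (suc zero))    | _ = ⊥-elim (p∤6 (divides 2 refl))
... | suc (suc (suc (suc _))) | _ = s≤s (s≤s (s≤s (s≤s z≤n)))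

prime∣n⇒3<p : ∀ {n p} → gcd n 6 ≡ 1 → Prime p → p ∣ n → 3 < p
prime∣n⇒3<p {n} gcd≡1 p-prime p∣n = prime∤6⇒3<p p-prime λ p∣6 →
  ℕP.<-irrefl refl (ℕP.<-≤-trans (prime>1 p-prime)
    (ℕ∣.∣⇒≤ (subst (_ ∣_) gcd≡1 (gcd-greatest p∣n p∣6))))

prime∤prime : ∀ {p q} → Prime p → Prime q → p ≢ q → ¬ p ∣ q
prime∤prime p-prime q-prime p≢q p∣q with prime⇒irreducible q-prime p∣q
... | inj₁ refl = ℕP.<-irrefl refl (prime>1 p-prime)
... | inj₂ p≡q  = p≢q p≡q

prime∤product : ∀ {p q r} → Prime p → Prime q → Prime r → p ≢ q → p ≢ r → ¬ p ∣ q * r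
prime∤product {p} {q} {r} p-prime q-prime r-prime p≢q p≢r p∣qr with euclidsLemma q r p-prime p∣qr
... | inj₁ p∣q = prime∤prime p-prime q-prime p≢q p∣q
... | inj₂ p∣r = prime∤prime p-prime r-prime p≢r p∣r

prime∤1 : ∀ {p} → Prime p → ¬ p ∣ 1
prime∤1 p-prime p∣1 = ℕP.<-irrefl (sym (ℕ∣.∣1⇒≡1 p∣1)) (prime>1 p-prime)

prime∤⇒coprime : ∀ {q u} → Prime q → ¬ q ∣ u → Coprime u q
prime∤⇒coprime p-prime q∤u (d∣u , d∣q) with prime⇒irreducible p-prime d∣q
... | inj₁ d≡1  = d≡1
... | inj₂ refl = ⊥-elim (q∤u d∣u)

coprime-* : ∀ {u x y} → Coprime u x → Coprime u y → Coprime u (x * y)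
coprime-* {u} {x} {y} u⊥x u⊥y {d} (d∣u , d∣xy) = u⊥y (d∣u , Coprimality.coprime-divisor d⊥x d∣xy)
  where d⊥x : Coprime d x
        d⊥x (e∣d , e∣x) = u⊥x (ℕ∣.∣-trans e∣d d∣u , e∣x)

-- The residues used below: 0 < |k| ≤ 3, so no prime q > 3 divides k.
Small : ℤ → Set
Small k = True (1 ℕ.≤? ℤ.∣ k ∣) × True (ℤ.∣ k ∣ ℕ.≤? 3)

residue⇒∤ : ∀ {q u} k → Small k → 3 < q → + u ≈ k mod + q → ¬ q ∣ u
residue⇒∤ {q} {u} k (k≢0 , k≤3) 3<q (divides-difference q∣u-k) q∣u =
  ℕP.<-irrefl refl (ℕP.<-≤-trans 3<q
    (ℕP.≤-trans (ℕ∣.∣⇒≤ ⦃ ℕ.>-nonZero (toWitness k≢0) ⦄ q∣∣k∣) (toWitness k≤3)))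
  where
  q∣k : + q ∣ᶻ k
  q∣k = subst (+ q ∣ᶻ_) (lemma (+ u) k) (ℤ∣.∣m∣n⇒∣m-n (ℤ∣.∣ᵤ⇒∣ {+ q} {+ u} q∣u) q∣u-k)
    where lemma : ∀ u k → u ℤ.- (u ℤ.- k) ≡ k
          lemma = solve-∀
  q∣∣k∣ : q ∣ ℤ.∣ k ∣
  q∣∣k∣ = ℤ∣.∣⇒∣ᵤ {+ q} {k} q∣k

coprime-to-factorisation : ∀ {n q₁ q₂ q₃ u} → Factorisation n q₁ q₂ q₃ →
                           ¬ q₁ ∣ u → ¬ q₂ ∣ u → ¬ q₃ ∣ u → Coprime u n
coprime-to-factorisation {u = u} fact q₁∤u q₂∤u q₃∤u =
  subst (Coprime u) (sym n≡)
    (coprime-* (coprime-* (prime∤⇒coprime prime₁ q₁∤u) (prime∤⇒coprime prime₂ q₂∤u))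
               (prime∤⇒coprime prime₃ q₃∤u))
  where open Factorisation fact

≈mod-via : ∀ {N x y} z → N ∣ᶻ z → x ℤ.- y ≡ z → x ≈ y mod N
≈mod-via {N} z N∣z x-y≡z = divides-difference (subst (N ∣ᶻ_) (sym x-y≡z) N∣z)

∣-+ : ∀ {N x y} → N ∣ᶻ x → N ∣ᶻ y → N ∣ᶻ x ℤ.+ y
∣-+ = ℤ∣.∣m∣n⇒∣m+n

∣-scale : ∀ {N} k {x} → N ∣ᶻ x → N ∣ᶻ k ℤ.* x
∣-scale = ℤ∣.∣n⇒∣m*n

∣-self : ∀ N k → N ∣ᶻ N ℤ.* k
∣-self N k = ℤ∣.∣m⇒∣m*n k ℤ∣.∣-refl

product∣product : ∀ {N P Q x y} → N ≡ P ℤ.* Q → P ∣ᶻ x → Q ∣ᶻ y → N ∣ᶻ x ℤ.* y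
product∣product {P = P} {Q} refl (ℤ∣.divides p refl) (ℤ∣.divides q refl) =
  ℤ∣.divides (p ℤ.* q) (lemma p P q Q)
  where lemma : ∀ p P q Q → p ℤ.* P ℤ.* (q ℤ.* Q) ≡ p ℤ.* q ℤ.* (P ℤ.* Q)
        lemma = solve-∀

∣-*ˡ : ∀ P Q {x} → P ℤ.* Q ∣ᶻ x → P ∣ᶻ x
∣-*ˡ P Q = ℤ∣.∣-trans (ℤ∣.∣m⇒∣m*n Q ℤ∣.∣-refl)

∣-*ʳ : ∀ P Q {x} → P ℤ.* Q ∣ᶻ x → Q ∣ᶻ x
∣-*ʳ P Q = ℤ∣.∣-trans (ℤ∣.∣n⇒∣m*n P ℤ∣.∣-refl)

module Factors (N Q₁ Q₂ Q₃ : ℤ) (N≡ : N ≡ Q₁ ℤ.* Q₂ ℤ.* Q₃) where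

  N≡[13]2 : N ≡ (Q₁ ℤ.* Q₃) ℤ.* Q₂
  N≡[13]2 = trans N≡ (lemma Q₁ Q₂ Q₃)
    where lemma : ∀ a b c → a ℤ.* b ℤ.* c ≡ a ℤ.* c ℤ.* b
          lemma = solve-∀

  N≡[23]1 : N ≡ (Q₂ ℤ.* Q₃) ℤ.* Q₁
  N≡[23]1 = trans N≡ (lemma Q₁ Q₂ Q₃)
    where lemma : ∀ a b c → a ℤ.* b ℤ.* c ≡ b ℤ.* c ℤ.* a
          lemma = solve-∀

  Q₁∣N : Q₁ ∣ᶻ N
  Q₁∣N = subst (Q₁ ∣ᶻ_) (sym N≡) (ℤ∣.∣m⇒∣m*n Q₃ (ℤ∣.∣m⇒∣m*n Q₂ ℤ∣.∣-refl))

  Q₂∣N : Q₂ ∣ᶻ N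
  Q₂∣N = subst (Q₂ ∣ᶻ_) (sym N≡) (ℤ∣.∣m⇒∣m*n Q₃ (ℤ∣.∣n⇒∣m*n Q₁ ℤ∣.∣-refl))

  Q₃∣N : Q₃ ∣ᶻ N
  Q₃∣N = subst (Q₃ ∣ᶻ_) (sym N≡) (ℤ∣.∣n⇒∣m*n (Q₁ ℤ.* Q₂) ℤ∣.∣-refl)

record IntegerCertificate (N Q₁ Q₂ Q₃ A B : ℤ) : Set where
  field
    U M₂ M₃ M₄ : ℤ
    total      : U ℤ.+ (M₂ ℤ.+ (M₃ ℤ.+ M₄)) ≡ N
    coeff₂     : M₂ ≈ U ℤ.* (A ℤ.+ B ℤ.- + 1) mod N
    coeff₃     : M₃ ≈ U ℤ.* (N ℤ.- B) mod N
    coeff₄     : M₄ ≈ U ℤ.* (N ℤ.- A) mod N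
    k₁ k₂ k₃   : ℤ
    small₁     : Small k₁
    small₂     : Small k₂
    small₃     : Small k₃
    residue₁   : U ≈ k₁ mod Q₁
    residue₂   : U ≈ k₂ mod Q₂
    residue₃   : U ≈ k₃ mod Q₃

realise : ∀ {n a b q₁ q₂ q₃} → Factorisation n q₁ q₂ q₃ →
  (cert : IntegerCertificate (+ n) (+ q₁) (+ q₂) (+ q₃) (+ a) (+ b)) →
  let open IntegerCertificate cert in
  (u m₂ m₃ m₄ : ℕ) → + u ≡ U → + m₂ ≡ M₂ → + m₃ ≡ M₃ → + m₄ ≡ M₄ →
  0 < m₂ → 0 < m₃ → 0 < m₄ → Certificate n a b
realise fact cert u m₂ m₃ m₄ refl refl refl refl m₂-pos m₃-pos m₄-pos = record
  { u = u ; m₂ = m₂ ; m₃ = m₃ ; m₄ = m₄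
  ; unit   = coprime-to-factorisation fact (residue⇒∤ k₁ small₁ 3<q₁ residue₁)
               (residue⇒∤ k₂ small₂ 3<q₂ residue₂) (residue⇒∤ k₃ small₃ 3<q₃ residue₃)
  ; m₂-pos = m₂-pos ; m₃-pos = m₃-pos ; m₄-pos = m₄-pos
  ; total  = total ; coeff₂ = coeff₂ ; coeff₃ = coeff₃ ; coeff₄ = coeff₄
  }
  where open IntegerCertificate cert
        open Factorisation fact

-- The integer identities behind the four certificates.  Throughout,
-- N = Q₁Q₂Q₃ and C = A + B - 1 stand for n, the primes, and c = a + b - 1.

-- Case (A4): Q₁Q₂ ∣ C, Q₁Q₃ ∣ B, Q₂Q₃ ∣ A.  Take U = N - 1 - 2C, with coefficients
-- U, C, B, A; U ≡ -1 modulo Q₁ and Q₂ (which divide C), and U ≡ 1 modulo Q₃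
-- (which divides A and B, so C ≡ -1).
module AlgebraA4 (N Q₁ Q₂ Q₃ A B : ℤ) (N≡ : N ≡ Q₁ ℤ.* Q₂ ℤ.* Q₃)
  (Q₁Q₂∣C : Q₁ ℤ.* Q₂ ∣ᶻ A ℤ.+ B ℤ.- + 1) (Q₁Q₃∣B : Q₁ ℤ.* Q₃ ∣ᶻ B)
  (Q₂Q₃∣A : Q₂ ℤ.* Q₃ ∣ᶻ A) where
  open Factors N Q₁ Q₂ Q₃ N≡

  C U : ℤ
  C = A ℤ.+ B ℤ.- + 1
  U = N ℤ.- (+ 1 ℤ.+ + 2 ℤ.* C)

  Q₃∣A+B : Q₃ ∣ᶻ A ℤ.+ B
  Q₃∣A+B = ∣-+ (∣-*ʳ Q₂ Q₃ Q₂Q₃∣A) (∣-*ʳ Q₁ Q₃ Q₁Q₃∣B)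

  total : U ℤ.+ (C ℤ.+ (B ℤ.+ A)) ≡ N
  total = identity N A B
    where identity : ∀ N A B → N ℤ.- (+ 1 ℤ.+ + 2 ℤ.* (A ℤ.+ B ℤ.- + 1)) ℤ.+
                                 ((A ℤ.+ B ℤ.- + 1) ℤ.+ (B ℤ.+ A)) ≡ N
          identity = solve-∀

  coeff₂ : C ≈ U ℤ.* C mod N
  coeff₂ = ≈mod-via _ (∣-+ (∣-scale (+ 2) (product∣product N≡ Q₁Q₂∣C Q₃∣A+B)) (∣-self N (ℤ.- C)))
                    (identity N A B)
    where identity : ∀ N A B → let C = A ℤ.+ B ℤ.- + 1 in
                     C ℤ.- (N ℤ.- (+ 1 ℤ.+ + 2 ℤ.* C)) ℤ.* C ≡ + 2 ℤ.* (C ℤ.* (A ℤ.+ B)) ℤ.+ N ℤ.* ℤ.- C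
          identity = solve-∀

  coeff₃ : B ≈ U ℤ.* (N ℤ.- B) mod N
  coeff₃ = ≈mod-via _ (∣-+ (∣-self N (B ℤ.- U))
                           (∣-scale (ℤ.- + 2) (product∣product N≡[13]2 Q₁Q₃∣B (∣-*ʳ Q₁ Q₂ Q₁Q₂∣C))))
                    (identity N A B)
    where identity : ∀ N A B → let C = A ℤ.+ B ℤ.- + 1 ; U = N ℤ.- (+ 1 ℤ.+ + 2 ℤ.* C) in
                     B ℤ.- U ℤ.* (N ℤ.- B) ≡ N ℤ.* (B ℤ.- U) ℤ.+ ℤ.- + 2 ℤ.* (B ℤ.* C)
          identity = solve-∀

  coeff₄ : A ≈ U ℤ.* (N ℤ.- A) mod N
  coeff₄ = ≈mod-via _ (∣-+ (∣-self N (A ℤ.- U))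
                           (∣-scale (ℤ.- + 2) (product∣product N≡[23]1 Q₂Q₃∣A (∣-*ˡ Q₁ Q₂ Q₁Q₂∣C))))
                    (identity N A B)
    where identity : ∀ N A B → let C = A ℤ.+ B ℤ.- + 1 ; U = N ℤ.- (+ 1 ℤ.+ + 2 ℤ.* C) in
                     A ℤ.- U ℤ.* (N ℤ.- A) ≡ N ℤ.* (A ℤ.- U) ℤ.+ ℤ.- + 2 ℤ.* (A ℤ.* C)
          identity = solve-∀

  residue₁ : U ≈ ℤ.- + 1 mod Q₁
  residue₁ = ≈mod-via _ (∣-+ Q₁∣N (∣-scale (ℤ.- + 2) (∣-*ˡ Q₁ Q₂ Q₁Q₂∣C))) (identity N C)
    where identity : ∀ N C → N ℤ.- (+ 1 ℤ.+ + 2 ℤ.* C) ℤ.- ℤ.- + 1 ≡ N ℤ.+ ℤ.- + 2 ℤ.* C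
          identity = solve-∀

  residue₂ : U ≈ ℤ.- + 1 mod Q₂
  residue₂ = ≈mod-via _ (∣-+ Q₂∣N (∣-scale (ℤ.- + 2) (∣-*ʳ Q₁ Q₂ Q₁Q₂∣C))) (identity N C)
    where identity : ∀ N C → N ℤ.- (+ 1 ℤ.+ + 2 ℤ.* C) ℤ.- ℤ.- + 1 ≡ N ℤ.+ ℤ.- + 2 ℤ.* C
          identity = solve-∀

  residue₃ : U ≈ + 1 mod Q₃
  residue₃ = ≈mod-via _ (∣-+ Q₃∣N (∣-scale (ℤ.- + 2) Q₃∣A+B)) (identity N A B)
    where identity : ∀ N A B → N ℤ.- (+ 1 ℤ.+ + 2 ℤ.* (A ℤ.+ B ℤ.- + 1)) ℤ.- + 1 ≡ N ℤ.+ ℤ.- + 2 ℤ.* (A ℤ.+ B)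
          identity = solve-∀

  certificate : IntegerCertificate N Q₁ Q₂ Q₃ A B
  certificate = record
    { U = U ; M₂ = C ; M₃ = B ; M₄ = A ; total = total
    ; coeff₂ = coeff₂ ; coeff₃ = coeff₃ ; coeff₄ = coeff₄
    ; k₁ = ℤ.- + 1 ; k₂ = ℤ.- + 1 ; k₃ = + 1 ; small₁ = _ ; small₂ = _ ; small₃ = _
    ; residue₁ = residue₁ ; residue₂ = residue₂ ; residue₃ = residue₃
    }

-- Case (A3): Q₁Q₂ ∣ A + B, Q₁Q₃ ∣ B - 1, Q₂Q₃ ∣ A - 1.  Take U = N + 2 - 2A - B, with
-- coefficients U, A - 2, 2A - 1, B + 1 - A; U ≡ 3, 1, -1 modulo Q₁, Q₂, Q₃.
-- The congruences follow from N dividing (A-1)(A+1), (A-1)(B-1) and (B-1)(B+1).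
module AlgebraA3 (N Q₁ Q₂ Q₃ A B : ℤ) (N≡ : N ≡ Q₁ ℤ.* Q₂ ℤ.* Q₃)
  (Q₁Q₂∣A+B : Q₁ ℤ.* Q₂ ∣ᶻ A ℤ.+ B) (Q₁Q₃∣B-1 : Q₁ ℤ.* Q₃ ∣ᶻ B ℤ.- + 1)
  (Q₂Q₃∣A-1 : Q₂ ℤ.* Q₃ ∣ᶻ A ℤ.- + 1) where
  open Factors N Q₁ Q₂ Q₃ N≡

  C U M₂ M₃ M₄ : ℤ
  C  = A ℤ.+ B ℤ.- + 1
  U  = N ℤ.+ + 2 ℤ.- (+ 2 ℤ.* A ℤ.+ B)
  M₂ = A ℤ.- + 2
  M₃ = A ℤ.+ (A ℤ.- + 1)
  M₄ = + 1 ℤ.+ (B ℤ.- A)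

  Q₁∣A+1 : Q₁ ∣ᶻ A ℤ.+ + 1
  Q₁∣A+1 = subst (Q₁ ∣ᶻ_) (identity A B) (ℤ∣.∣m∣n⇒∣m-n (∣-*ˡ Q₁ Q₂ Q₁Q₂∣A+B) (∣-*ˡ Q₁ Q₃ Q₁Q₃∣B-1))
    where identity : ∀ A B → A ℤ.+ B ℤ.- (B ℤ.- + 1) ≡ A ℤ.+ + 1
          identity = solve-∀

  Q₂∣B+1 : Q₂ ∣ᶻ B ℤ.+ + 1
  Q₂∣B+1 = subst (Q₂ ∣ᶻ_) (identity A B) (ℤ∣.∣m∣n⇒∣m-n (∣-*ʳ Q₁ Q₂ Q₁Q₂∣A+B) (∣-*ˡ Q₂ Q₃ Q₂Q₃∣A-1))
    where identity : ∀ A B → A ℤ.+ B ℤ.- (A ℤ.- + 1) ≡ B ℤ.+ + 1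
          identity = solve-∀

  N∣[A-1][A+1] : N ∣ᶻ (A ℤ.- + 1) ℤ.* (A ℤ.+ + 1)
  N∣[A-1][A+1] = product∣product N≡[23]1 Q₂Q₃∣A-1 Q₁∣A+1

  N∣[A-1][B-1] : N ∣ᶻ (A ℤ.- + 1) ℤ.* (B ℤ.- + 1)
  N∣[A-1][B-1] = product∣product N≡[23]1 Q₂Q₃∣A-1 (∣-*ˡ Q₁ Q₃ Q₁Q₃∣B-1)

  N∣[B-1][B+1] : N ∣ᶻ (B ℤ.- + 1) ℤ.* (B ℤ.+ + 1)
  N∣[B-1][B+1] = product∣product N≡[13]2 Q₁Q₃∣B-1 Q₂∣B+1

  total : U ℤ.+ (M₂ ℤ.+ (M₃ ℤ.+ M₄)) ≡ N
  total = identity N A B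
    where identity : ∀ N A B → N ℤ.+ + 2 ℤ.- (+ 2 ℤ.* A ℤ.+ B) ℤ.+
                               ((A ℤ.- + 2) ℤ.+ ((A ℤ.+ (A ℤ.- + 1)) ℤ.+ (+ 1 ℤ.+ (B ℤ.- A)))) ≡ N
          identity = solve-∀

  coeff₂ : M₂ ≈ U ℤ.* C mod N
  coeff₂ = ≈mod-via _ (∣-+ (∣-self N (ℤ.- C))
                           (∣-+ (∣-scale (+ 2) N∣[A-1][A+1]) (∣-+ (∣-scale (+ 3) N∣[A-1][B-1]) N∣[B-1][B+1])))
                    (identity N A B)
    where identity : ∀ N A B → let C = A ℤ.+ B ℤ.- + 1 ; U = N ℤ.+ + 2 ℤ.- (+ 2 ℤ.* A ℤ.+ B) in
                     A ℤ.- + 2 ℤ.- U ℤ.* C ≡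
                     N ℤ.* ℤ.- C ℤ.+ (+ 2 ℤ.* ((A ℤ.- + 1) ℤ.* (A ℤ.+ + 1)) ℤ.+
                       (+ 3 ℤ.* ((A ℤ.- + 1) ℤ.* (B ℤ.- + 1)) ℤ.+ (B ℤ.- + 1) ℤ.* (B ℤ.+ + 1)))
          identity = solve-∀

  coeff₃ : M₃ ≈ U ℤ.* (N ℤ.- B) mod N
  coeff₃ = ≈mod-via _ (∣-+ (∣-self N (B ℤ.- U))
                           (∣-+ (∣-scale (ℤ.- + 2) N∣[A-1][B-1]) (∣-scale (ℤ.- + 1) N∣[B-1][B+1])))
                    (identity N A B)
    where identity : ∀ N A B → let U = N ℤ.+ + 2 ℤ.- (+ 2 ℤ.* A ℤ.+ B) in
                     A ℤ.+ (A ℤ.- + 1) ℤ.- U ℤ.* (N ℤ.- B) ≡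
                     N ℤ.* (B ℤ.- U) ℤ.+ (ℤ.- + 2 ℤ.* ((A ℤ.- + 1) ℤ.* (B ℤ.- + 1)) ℤ.+
                       ℤ.- + 1 ℤ.* ((B ℤ.- + 1) ℤ.* (B ℤ.+ + 1)))
          identity = solve-∀

  coeff₄ : M₄ ≈ U ℤ.* (N ℤ.- A) mod N
  coeff₄ = ≈mod-via _ (∣-+ (∣-self N (A ℤ.- U))
                           (∣-+ (∣-scale (ℤ.- + 2) N∣[A-1][A+1]) (∣-scale (ℤ.- + 1) N∣[A-1][B-1])))
                    (identity N A B)
    where identity : ∀ N A B → let U = N ℤ.+ + 2 ℤ.- (+ 2 ℤ.* A ℤ.+ B) in
                     + 1 ℤ.+ (B ℤ.- A) ℤ.- U ℤ.* (N ℤ.- A) ≡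
                     N ℤ.* (A ℤ.- U) ℤ.+ (ℤ.- + 2 ℤ.* ((A ℤ.- + 1) ℤ.* (A ℤ.+ + 1)) ℤ.+
                       ℤ.- + 1 ℤ.* ((A ℤ.- + 1) ℤ.* (B ℤ.- + 1)))
          identity = solve-∀

  residue₁ : U ≈ + 3 mod Q₁
  residue₁ = ≈mod-via _ (∣-+ Q₁∣N (∣-+ (∣-scale (ℤ.- + 2) (∣-*ˡ Q₁ Q₂ Q₁Q₂∣A+B)) (∣-*ˡ Q₁ Q₃ Q₁Q₃∣B-1)))
                      (identity N A B)
    where identity : ∀ N A B → N ℤ.+ + 2 ℤ.- (+ 2 ℤ.* A ℤ.+ B) ℤ.- + 3 ≡
                               N ℤ.+ (ℤ.- + 2 ℤ.* (A ℤ.+ B) ℤ.+ (B ℤ.- + 1))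
          identity = solve-∀

  residue₂ : U ≈ + 1 mod Q₂
  residue₂ = ≈mod-via _ (∣-+ Q₂∣N (∣-+ (∣-scale (ℤ.- + 1) (∣-*ʳ Q₁ Q₂ Q₁Q₂∣A+B))
                                       (∣-scale (ℤ.- + 1) (∣-*ˡ Q₂ Q₃ Q₂Q₃∣A-1))))
                      (identity N A B)
    where identity : ∀ N A B → N ℤ.+ + 2 ℤ.- (+ 2 ℤ.* A ℤ.+ B) ℤ.- + 1 ≡
                               N ℤ.+ (ℤ.- + 1 ℤ.* (A ℤ.+ B) ℤ.+ ℤ.- + 1 ℤ.* (A ℤ.- + 1))
          identity = solve-∀

  residue₃ : U ≈ ℤ.- + 1 mod Q₃
  residue₃ = ≈mod-via _ (∣-+ Q₃∣N (∣-+ (∣-scale (ℤ.- + 2) (∣-*ʳ Q₂ Q₃ Q₂Q₃∣A-1))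
                                       (∣-scale (ℤ.- + 1) (∣-*ʳ Q₁ Q₃ Q₁Q₃∣B-1))))
                      (identity N A B)
    where identity : ∀ N A B → N ℤ.+ + 2 ℤ.- (+ 2 ℤ.* A ℤ.+ B) ℤ.- ℤ.- + 1 ≡
                               N ℤ.+ (ℤ.- + 2 ℤ.* (A ℤ.- + 1) ℤ.+ ℤ.- + 1 ℤ.* (B ℤ.- + 1))
          identity = solve-∀

  certificate : IntegerCertificate N Q₁ Q₂ Q₃ A B
  certificate = record
    { U = U ; M₂ = M₂ ; M₃ = M₃ ; M₄ = M₄ ; total = total
    ; coeff₂ = coeff₂ ; coeff₃ = coeff₃ ; coeff₄ = coeff₄
    ; k₁ = + 3 ; k₂ = + 1 ; k₃ = ℤ.- + 1 ; small₁ = _ ; small₂ = _ ; small₃ = _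
    ; residue₁ = residue₁ ; residue₂ = residue₂ ; residue₃ = residue₃
    }

-- Case (A2), common part: Q₁Q₃ ∣ X - 1 and Q₂ ∣ X, where X is a or b.  Take U = X - 2:
-- U ≡ -1 modulo Q₁ and Q₃, U ≡ -2 modulo Q₂, and N ∣ (X - 1)Z whenever Q₂ ∣ Z.
module ShiftedUnit (N Q₁ Q₂ Q₃ X : ℤ) (N≡ : N ≡ Q₁ ℤ.* Q₂ ℤ.* Q₃)
  (Q₁Q₃∣X-1 : Q₁ ℤ.* Q₃ ∣ᶻ X ℤ.- + 1) (Q₂∣X : Q₂ ∣ᶻ X) where
  open Factors N Q₁ Q₂ Q₃ N≡

  U : ℤ
  U = X ℤ.- + 2

  N∣[X-1]Z : ∀ {Z} → Q₂ ∣ᶻ Z → N ∣ᶻ (X ℤ.- + 1) ℤ.* Z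
  N∣[X-1]Z = product∣product N≡[13]2 Q₁Q₃∣X-1

  coeff-fixed : ∀ {Z} → Q₂ ∣ᶻ Z → Z ≈ U ℤ.* (N ℤ.- Z) mod N
  coeff-fixed {Z} Q₂∣Z = ≈mod-via _ (∣-+ (N∣[X-1]Z Q₂∣Z) (∣-self N (ℤ.- U))) (identity N X Z)
    where identity : ∀ N X Z → Z ℤ.- (X ℤ.- + 2) ℤ.* (N ℤ.- Z) ≡
                               (X ℤ.- + 1) ℤ.* Z ℤ.+ N ℤ.* ℤ.- (X ℤ.- + 2)
          identity = solve-∀

  residue₁ : U ≈ ℤ.- + 1 mod Q₁
  residue₁ = ≈mod-via _ (∣-*ˡ Q₁ Q₃ Q₁Q₃∣X-1) (identity X)
    where identity : ∀ X → X ℤ.- + 2 ℤ.- ℤ.- + 1 ≡ X ℤ.- + 1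
          identity = solve-∀

  residue₂ : U ≈ ℤ.- + 2 mod Q₂
  residue₂ = ≈mod-via _ Q₂∣X (identity X)
    where identity : ∀ X → X ℤ.- + 2 ℤ.- ℤ.- + 2 ≡ X
          identity = solve-∀

  residue₃ : U ≈ ℤ.- + 1 mod Q₃
  residue₃ = ≈mod-via _ (∣-*ʳ Q₁ Q₃ Q₁Q₃∣X-1) (identity X)
    where identity : ∀ X → X ℤ.- + 2 ℤ.- ℤ.- + 1 ≡ X ℤ.- + 1
          identity = solve-∀

-- Case (A2) with Q₂ ∣ A, Q₂ ∣ C and (from reducedness) Q₁Q₃ ∣ A - 1.  Take U = A - 2,
-- with coefficients U, N - C, B - A + 1, A.
module AlgebraA2c (N Q₁ Q₂ Q₃ A B : ℤ) (N≡ : N ≡ Q₁ ℤ.* Q₂ ℤ.* Q₃)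
  (Q₁Q₃∣A-1 : Q₁ ℤ.* Q₃ ∣ᶻ A ℤ.- + 1) (Q₂∣A : Q₂ ∣ᶻ A) (Q₂∣C : Q₂ ∣ᶻ A ℤ.+ B ℤ.- + 1) where
  open ShiftedUnit N Q₁ Q₂ Q₃ A N≡ Q₁Q₃∣A-1 Q₂∣A public

  C M₂ M₃ : ℤ
  C  = A ℤ.+ B ℤ.- + 1
  M₂ = N ℤ.- C
  M₃ = + 1 ℤ.+ (B ℤ.- A)

  total : U ℤ.+ (M₂ ℤ.+ (M₃ ℤ.+ A)) ≡ N
  total = identity N A B
    where identity : ∀ N A B → A ℤ.- + 2 ℤ.+ ((N ℤ.- (A ℤ.+ B ℤ.- + 1)) ℤ.+ ((+ 1 ℤ.+ (B ℤ.- A)) ℤ.+ A)) ≡ N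
          identity = solve-∀

  coeff₂ : M₂ ≈ U ℤ.* C mod N
  coeff₂ = ≈mod-via _ (∣-+ (∣-self N (+ 1)) (∣-scale (ℤ.- + 1) (N∣[X-1]Z Q₂∣C))) (identity N A B)
    where identity : ∀ N A B → let C = A ℤ.+ B ℤ.- + 1 in
                     N ℤ.- C ℤ.- (A ℤ.- + 2) ℤ.* C ≡ N ℤ.* + 1 ℤ.+ ℤ.- + 1 ℤ.* ((A ℤ.- + 1) ℤ.* C)
          identity = solve-∀

  coeff₃ : M₃ ≈ U ℤ.* (N ℤ.- B) mod N
  coeff₃ = ≈mod-via _ (∣-+ (N∣[X-1]Z Q₂∣B-1) (∣-self N (ℤ.- U))) (identity N A B)
    where
    Q₂∣B-1 : Q₂ ∣ᶻ B ℤ.- + 1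
    Q₂∣B-1 = subst (Q₂ ∣ᶻ_) (identity′ A B) (ℤ∣.∣m∣n⇒∣m-n Q₂∣C Q₂∣A)
      where identity′ : ∀ A B → A ℤ.+ B ℤ.- + 1 ℤ.- A ≡ B ℤ.- + 1
            identity′ = solve-∀
    identity : ∀ N A B → + 1 ℤ.+ (B ℤ.- A) ℤ.- (A ℤ.- + 2) ℤ.* (N ℤ.- B) ≡
                         (A ℤ.- + 1) ℤ.* (B ℤ.- + 1) ℤ.+ N ℤ.* ℤ.- (A ℤ.- + 2)
    identity = solve-∀

  certificate : IntegerCertificate N Q₁ Q₂ Q₃ A B
  certificate = record
    { U = U ; M₂ = M₂ ; M₃ = M₃ ; M₄ = A ; total = total
    ; coeff₂ = coeff₂ ; coeff₃ = coeff₃ ; coeff₄ = coeff-fixed Q₂∣A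
    ; k₁ = ℤ.- + 1 ; k₂ = ℤ.- + 2 ; k₃ = ℤ.- + 1 ; small₁ = _ ; small₂ = _ ; small₃ = _
    ; residue₁ = residue₁ ; residue₂ = residue₂ ; residue₃ = residue₃
    }

-- Case (A2) with Q₂ ∣ X, Q₂ ∣ Y and (from reducedness) Q₁Q₃ ∣ X - 1, where {X, Y} = {A, B}
-- and C = X + Y - 1.  Take U = X - 2, with coefficients U, N + 2 - 2X - Y, Y, X.
module AlgebraA2ab (N Q₁ Q₂ Q₃ X Y : ℤ) (N≡ : N ≡ Q₁ ℤ.* Q₂ ℤ.* Q₃)
  (Q₁Q₃∣X-1 : Q₁ ℤ.* Q₃ ∣ᶻ X ℤ.- + 1) (Q₂∣X : Q₂ ∣ᶻ X) (Q₂∣Y : Q₂ ∣ᶻ Y) where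
  open ShiftedUnit N Q₁ Q₂ Q₃ X N≡ Q₁Q₃∣X-1 Q₂∣X public

  M₂ : ℤ
  M₂ = N ℤ.+ + 2 ℤ.- (+ 2 ℤ.* X ℤ.+ Y)

  total : U ℤ.+ (M₂ ℤ.+ (Y ℤ.+ X)) ≡ N
  total = identity N X Y
    where identity : ∀ N X Y → X ℤ.- + 2 ℤ.+ ((N ℤ.+ + 2 ℤ.- (+ 2 ℤ.* X ℤ.+ Y)) ℤ.+ (Y ℤ.+ X)) ≡ N
          identity = solve-∀

  coeff₂ : M₂ ≈ U ℤ.* (X ℤ.+ Y ℤ.- + 1) mod N
  coeff₂ = ≈mod-via _ (∣-+ (∣-self N (+ 1)) (∣-scale (ℤ.- + 1) (N∣[X-1]Z (∣-+ Q₂∣X Q₂∣Y)))) (identity N X Y)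
    where identity : ∀ N X Y → N ℤ.+ + 2 ℤ.- (+ 2 ℤ.* X ℤ.+ Y) ℤ.- (X ℤ.- + 2) ℤ.* (X ℤ.+ Y ℤ.- + 1) ≡
                               N ℤ.* + 1 ℤ.+ ℤ.- + 1 ℤ.* ((X ℤ.- + 1) ℤ.* (X ℤ.+ Y))
          identity = solve-∀

  certificate : IntegerCertificate N Q₁ Q₂ Q₃ X Y
  certificate = record
    { U = U ; M₂ = M₂ ; M₃ = Y ; M₄ = X ; total = total
    ; coeff₂ = coeff₂ ; coeff₃ = coeff-fixed Q₂∣Y ; coeff₄ = coeff-fixed Q₂∣X
    ; k₁ = ℤ.- + 1 ; k₂ = ℤ.- + 2 ; k₃ = ℤ.- + 1 ; small₁ = _ ; small₂ = _ ; small₃ = _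
    ; residue₁ = residue₁ ; residue₂ = residue₂ ; residue₃ = residue₃
    }

record Shape (n a b c : ℕ) : Set where
  field
    2≤a  : 2 ≤ a
    a≤b  : a ≤ b
    c≡   : 1 + c ≡ a + b
    2c<n : 2 * c < n

-- The hypotheses 1 < a (from n - a < n - 1) and a ≤ b (from n - b ≤ n - a, once
-- a < n, which holds as n - b > n/2 > 0).
shape : ∀ {n a b c} → 1 + c ≡ a + b → 2 * c < n → n < 2 * (n ∸ b) → n ∸ b ≤ n ∸ a →
        n ∸ a < n ∸ 1 → Shape n a b c
shape {n} {a} {b} {c} c≡ 2c<n n<2[n∸b] n∸b≤n∸a n∸a<n∸1 = record
  { 2≤a = ℕP.∸-cancelʳ-< n∸a<n∸1 ; a≤b = ℕP.∸-cancelʳ-≤ (ℕP.<⇒≤ a<n) n∸b≤n∸a ; c≡ = c≡ ; 2c<n = 2c<n }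
  where
  a<n : a < n
  a<n = ℕP.m∸n≢0⇒n<m λ n∸a≡0 →
    ℕP.n≮0 (subst (λ z → n < 2 * z) (ℕP.n≤0⇒n≡0 (subst (n ∸ b ≤_) n∸a≡0 n∸b≤n∸a)) n<2[n∸b])

module ShapeFacts {n a b c} (sh : Shape n a b c) where
  open Shape sh public

  c≡ᶻ : + c ≡ + a ℤ.+ + b ℤ.- + 1
  c≡ᶻ = pos-c {a} {b} {c} c≡

  0<a : 0 < a
  0<a = ℕP.<-trans (s≤s z≤n) 2≤a

  b≤c : b ≤ c
  b≤c = ℕP.+-cancelˡ-≤ 1 b c (subst (1 + b ≤_) (sym c≡) (ℕP.+-monoˡ-≤ b 0<a))

  0<b : 0 < b
  0<b = ℕP.<-≤-trans 0<a a≤b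

  0<c : 0 < c
  0<c = ℕP.<-≤-trans 0<b b≤c

  a+2b≤n : a + 2 * b ≤ n
  a+2b≤n = begin
    a + 2 * b       ≡⟨ lemma a b ⟩
    (a + b) + b     ≡⟨ cong (_+ b) c≡ ⟨
    1 + c + b       ≤⟨ ℕP.+-monoʳ-≤ (1 + c) b≤c ⟩
    1 + c + c       ≡⟨ lemma′ c ⟩
    1 + 2 * c       ≤⟨ 2c<n ⟩
    n               ∎
    where
    open ℕP.≤-Reasoning
    lemma : ∀ a b → a + 2 * b ≡ (a + b) + b
    lemma = ℕSolver.solve-∀
    lemma′ : ∀ c → 1 + c + c ≡ 1 + 2 * c
    lemma′ = ℕSolver.solve-∀

  2a+b≤n : 2 * a + b ≤ n
  2a+b≤n = ℕP.≤-trans (subst₂ _≤_ (lemma a b) (lemma′ a b) (ℕP.+-monoʳ-≤ (a + b) a≤b)) a+2b≤n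
    where lemma : ∀ a b → a + b + a ≡ 2 * a + b
          lemma = ℕSolver.solve-∀
          lemma′ : ∀ a b → a + b + b ≡ a + 2 * b
          lemma′ = ℕSolver.solve-∀

  b≤n : b ≤ n
  b≤n = ℕP.≤-trans (ℕP.m≤n+m b (a + b)) (subst (_≤ n) (lemma a b) a+2b≤n)
    where lemma : ∀ a b → a + 2 * b ≡ a + b + b
          lemma = ℕSolver.solve-∀

  a≤n : a ≤ n
  a≤n = ℕP.≤-trans a≤b b≤n

  c<n : c < n
  c<n = ℕP.<-≤-trans (s≤s (ℕP.m≤m+n c (c + 0))) 2c<n

pos-2x+y : ∀ x y → + (2 * x + y) ≡ + 2 ℤ.* + x ℤ.+ + y
pos-2x+y x y = trans (ℤP.pos-+ (2 * x) y) (cong (ℤ._+ + y) (ℤP.pos-* 2 x))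

pos-n+2∸[2x+y] : ∀ n x y → 2 * x + y ≤ n + 2 →
                 + (n + 2 ∸ (2 * x + y)) ≡ + n ℤ.+ + 2 ℤ.- (+ 2 ℤ.* + x ℤ.+ + y)
pos-n+2∸[2x+y] n x y le =
  trans (pos-∸ le) (cong₂ ℤ._-_ (ℤP.pos-+ n 2) (pos-2x+y x y))

pos-1+[y∸x] : ∀ {x y} → x ≤ y → + (1 + (y ∸ x)) ≡ + 1 ℤ.+ (+ y ℤ.- + x)
pos-1+[y∸x] {x} {y} x≤y = trans (ℤP.pos-+ 1 (y ∸ x)) (cong (λ z → + 1 ℤ.+ z) (pos-∸ x≤y))

pos-factorisation : ∀ {n q₁ q₂ q₃} → Factorisation n q₁ q₂ q₃ → + n ≡ + q₁ ℤ.* + q₂ ℤ.* + q₃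
pos-factorisation {n} {q₁} {q₂} {q₃} fact =
  trans (cong +_ (Factorisation.n≡ fact)) (trans (ℤP.pos-* (q₁ * q₂) q₃) (cong (ℤ._* + q₃) (ℤP.pos-* q₁ q₂)))

∣⇒∣ᶻ : ∀ {d x X} → d ∣ x → + x ≡ X → + d ∣ᶻ X
∣⇒∣ᶻ {d} {x} d∣x refl = ℤ∣.∣ᵤ⇒∣ {+ d} {+ x} d∣x

∣⇒∣ᶻ-pair : ∀ q r {x X} → q * r ∣ x → + x ≡ X → + q ℤ.* + r ∣ᶻ X
∣⇒∣ᶻ-pair q r d∣x x≡X = subst (_∣ᶻ _) (ℤP.pos-* q r) (∣⇒∣ᶻ d∣x x≡X)

gcd≡⇒∣ : ∀ {x n d} → gcd x n ≡ d → d ∣ x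
gcd≡⇒∣ {x} {n} refl = gcd[m,n]∣m x n

certificate-A4 : ∀ {n a b c q₁ q₂ q₃} → Shape n a b c → Factorisation n q₁ q₂ q₃ →
                 CaseA4 n a b c q₁ q₂ q₃ → Certificate n a b
certificate-A4 {n} {a} {b} {c} {q₁} {q₂} {q₃} sh fact (gcd[c]≡ , gcd[b]≡ , gcd[a]≡) =
  realise fact Algebra.certificate (n ∸ (1 + 2 * c)) c b a u≡U c≡ᶻ refl refl 0<c 0<b 0<a
  where
  open ShapeFacts sh
  module Algebra = AlgebraA4 (+ n) (+ q₁) (+ q₂) (+ q₃) (+ a) (+ b)
    (pos-factorisation fact) (∣⇒∣ᶻ-pair q₁ q₂ (gcd≡⇒∣ gcd[c]≡) c≡ᶻ)
    (∣⇒∣ᶻ-pair q₁ q₃ (gcd≡⇒∣ gcd[b]≡) refl) (∣⇒∣ᶻ-pair q₂ q₃ (gcd≡⇒∣ gcd[a]≡) refl)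
  u≡U : + (n ∸ (1 + 2 * c)) ≡ + n ℤ.- (+ 1 ℤ.+ + 2 ℤ.* (+ a ℤ.+ + b ℤ.- + 1))
  u≡U = trans (pos-∸ 2c<n) (cong (λ z → + n ℤ.- z) (trans (ℤP.pos-+ 1 (2 * c))
          (cong (λ z → + 1 ℤ.+ z) (trans (ℤP.pos-* 2 c) (cong (λ z → + 2 ℤ.* z) c≡ᶻ)))))

certificate-A3 : ∀ {n a b c q₁ q₂ q₃} → Shape n a b c → Factorisation n q₁ q₂ q₃ →
                 CaseA3 n a b c q₁ q₂ q₃ → Certificate n a b
certificate-A3 {n} {a} {b} {c} {q₁} {q₂} {q₃} sh fact (gcd[c+1]≡ , gcd[b-1]≡ , gcd[a-1]≡) =
  realise fact Algebra.certificate (n + 2 ∸ (2 * a + b)) (a ∸ 2) (a + (a ∸ 1)) (1 + (b ∸ a))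
    (pos-n+2∸[2x+y] n a b (ℕP.≤-trans 2a+b≤n (ℕP.m≤m+n n 2))) (pos-∸ 2≤a)
    (trans (ℤP.pos-+ a (a ∸ 1)) (cong (λ z → + a ℤ.+ z) (pos-∸ 0<a))) (pos-1+[y∸x] a≤b)
    (ℕP.m<n⇒0<n∸m 2<a) (ℕP.<-≤-trans 0<a (ℕP.m≤m+n a (a ∸ 1))) (s≤s z≤n)
  where
  open ShapeFacts sh
  open Factorisation fact using (prime₂)
  module Algebra = AlgebraA3 (+ n) (+ q₁) (+ q₂) (+ q₃) (+ a) (+ b)
    (pos-factorisation fact)
    (∣⇒∣ᶻ-pair q₁ q₂ (gcd≡⇒∣ gcd[c+1]≡) (trans (cong +_ (trans (ℕP.+-comm c 1) c≡)) (ℤP.pos-+ a b)))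
    (∣⇒∣ᶻ-pair q₁ q₃ (gcd≡⇒∣ gcd[b-1]≡) (pos-∸ 0<b)) (∣⇒∣ᶻ-pair q₂ q₃ (gcd≡⇒∣ gcd[a-1]≡) (pos-∸ 0<a))
  -- a = 2 would make q₂q₃ divide a - 1 = 1.
  2<a : 2 < a
  2<a = ℕP.≤∧≢⇒< 2≤a λ 2≡a → prime∤1 prime₂
          (ℕ∣.∣-trans (ℕ∣.m∣m*n q₃) (subst (λ z → q₂ * q₃ ∣ z ∸ 1) (sym 2≡a) (gcd≡⇒∣ gcd[a-1]≡)))

certificate-A2c : ∀ {n a b c q₁ q₂ q₃} → Shape n a b c → Factorisation n q₁ q₂ q₃ →
                  q₁ * q₃ ∣ a ∸ 1 → q₂ ∣ a → q₂ ∣ c → Certificate n a b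
certificate-A2c {n} {a} {b} {c} {q₁} {q₂} {q₃} sh fact q₁q₃∣a∸1 q₂∣a q₂∣c =
  realise fact Algebra.certificate (a ∸ 2) (n ∸ c) (1 + (b ∸ a)) a
    (pos-∸ 2≤a) (trans (pos-∸ (ℕP.<⇒≤ c<n)) (cong (λ z → + n ℤ.- z) c≡ᶻ)) (pos-1+[y∸x] a≤b) refl
    (ℕP.m<n⇒0<n∸m c<n) (s≤s z≤n) 0<a
  where
  open ShapeFacts sh
  module Algebra = AlgebraA2c (+ n) (+ q₁) (+ q₂) (+ q₃) (+ a) (+ b)
    (pos-factorisation fact) (∣⇒∣ᶻ-pair q₁ q₃ q₁q₃∣a∸1 (pos-∸ 0<a))
    (∣⇒∣ᶻ q₂∣a refl) (∣⇒∣ᶻ q₂∣c c≡ᶻ)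

-- Case (A2) with q₂ ∣ x, q₂ ∣ y and q₁q₃ ∣ x - 1: u = x - 2, with coefficients
-- u, n + 2 - 2x - y, y, x.  Used for (x, y) = (a, b) and, by symmetry, (b, a).
certificate-A2ab : ∀ {n x y q₁ q₂ q₃} → 2 ≤ x → 0 < y → 2 * x + y ≤ n → Factorisation n q₁ q₂ q₃ →
                   q₁ * q₃ ∣ x ∸ 1 → q₂ ∣ x → q₂ ∣ y → Certificate n x y
certificate-A2ab {n} {x} {y} {q₁} {q₂} {q₃} 2≤x 0<y 2x+y≤n fact q₁q₃∣x∸1 q₂∣x q₂∣y =
  realise fact Algebra.certificate (x ∸ 2) (n + 2 ∸ (2 * x + y)) y x
    (pos-∸ 2≤x) (pos-n+2∸[2x+y] n x y (ℕP.<⇒≤ 2x+y<n+2)) refl refl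
    (ℕP.m<n⇒0<n∸m 2x+y<n+2) 0<y (ℕP.<-trans (s≤s z≤n) 2≤x)
  where
  2x+y<n+2 : 2 * x + y < n + 2
  2x+y<n+2 = ℕP.≤-<-trans 2x+y≤n (ℕP.m<m+n n (s≤s z≤n))
  module Algebra = AlgebraA2ab (+ n) (+ q₁) (+ q₂) (+ q₃) (+ x) (+ y)
    (pos-factorisation fact) (∣⇒∣ᶻ-pair q₁ q₃ q₁q₃∣x∸1 (pos-∸ (ℕP.<⇒≤ 2≤x)))
    (∣⇒∣ᶻ q₂∣x refl) (∣⇒∣ᶻ q₂∣y refl)

-- Reducedness: short zero-sum pieces of q₂S.

ZeroSumPiece : ℕ → ℕ → ℕ → ℕ → ℕ → Set
ZeroSumPiece n x₁ x₂ x₃ x₄ =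
  ZeroSum n (x₁ ∷ []) ⊎ ZeroSum n (x₂ ∷ []) ⊎ ZeroSum n (x₃ ∷ []) ⊎ ZeroSum n (x₄ ∷ []) ⊎
  ZeroSum n (x₁ ∷ x₂ ∷ []) ⊎ ZeroSum n (x₁ ∷ x₃ ∷ []) ⊎ ZeroSum n (x₁ ∷ x₄ ∷ [])

zeroSum? : ∀ n T → Dec (ZeroSum n T)
zeroSum? n T = n ℕ∣.∣? (sum T + 0)

piece? : ∀ n x₁ x₂ x₃ x₄ → Dec (ZeroSumPiece n x₁ x₂ x₃ x₄)
piece? n x₁ x₂ x₃ x₄ =
  zeroSum? n (x₁ ∷ []) ⊎-dec zeroSum? n (x₂ ∷ []) ⊎-dec zeroSum? n (x₃ ∷ []) ⊎-dec
  zeroSum? n (x₄ ∷ []) ⊎-dec zeroSum? n (x₁ ∷ x₂ ∷ []) ⊎-dec zeroSum? n (x₁ ∷ x₃ ∷ []) ⊎-dec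
  zeroSum? n (x₁ ∷ x₄ ∷ [])

complement : ∀ {n} S T U → sum S ≡ sum T + sum U → ZeroSum n S → ZeroSum n T → ZeroSum n U
complement {n} S T U σ≡ zsS zsT =
  ∣⇒≡[]0 (ℕ∣.∣m+n∣m⇒∣n (subst (n ∣_) σ≡ (≡[]0⇒∣ zsS)) (≡[]0⇒∣ zsT))

-- A proper nonempty zero-sum subsequence of a zero-sum x₁x₂x₃x₄ is a piece, or the
-- complement of one.
proper⇒piece : ∀ {n x₁ x₂ x₃ x₄} T → ZeroSum n (x₁ ∷ x₂ ∷ x₃ ∷ x₄ ∷ []) →
  T ⊆ (x₁ ∷ x₂ ∷ x₃ ∷ x₄ ∷ []) → 0 < length T → length T < 4 → ZeroSum n T →
  ZeroSumPiece n x₁ x₂ x₃ x₄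
proper⇒piece _ _ (_ ∷ʳ (_ ∷ʳ (_ ∷ʳ (_ ∷ʳ [])))) () _
proper⇒piece _ _ (refl ∷ (refl ∷ (refl ∷ (refl ∷ [])))) _ (s≤s (s≤s (s≤s (s≤s ()))))
proper⇒piece _ _ (refl ∷ (_ ∷ʳ (_ ∷ʳ (_ ∷ʳ [])))) _ _ z = inj₁ z
proper⇒piece _ _ (_ ∷ʳ (refl ∷ (_ ∷ʳ (_ ∷ʳ [])))) _ _ z = inj₂ (inj₁ z)
proper⇒piece _ _ (_ ∷ʳ (_ ∷ʳ (refl ∷ (_ ∷ʳ [])))) _ _ z = inj₂ (inj₂ (inj₁ z))
proper⇒piece _ _ (_ ∷ʳ (_ ∷ʳ (_ ∷ʳ (refl ∷ [])))) _ _ z = inj₂ (inj₂ (inj₂ (inj₁ z)))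
proper⇒piece _ _ (refl ∷ (refl ∷ (_ ∷ʳ (_ ∷ʳ [])))) _ _ z = inj₂ (inj₂ (inj₂ (inj₂ (inj₁ z))))
proper⇒piece _ _ (refl ∷ (_ ∷ʳ (refl ∷ (_ ∷ʳ [])))) _ _ z = inj₂ (inj₂ (inj₂ (inj₂ (inj₂ (inj₁ z)))))
proper⇒piece _ _ (refl ∷ (_ ∷ʳ (_ ∷ʳ (refl ∷ [])))) _ _ z = inj₂ (inj₂ (inj₂ (inj₂ (inj₂ (inj₂ z)))))
proper⇒piece {x₁ = x₁} {x₂} {x₃} {x₄} _ zs (_ ∷ʳ (refl ∷ (refl ∷ (_ ∷ʳ [])))) _ _ z =
  inj₂ (inj₂ (inj₂ (inj₂ (inj₂ (inj₂ 
    (complement (x₁ ∷ x₂ ∷ x₃ ∷ x₄ ∷ []) (x₂ ∷ x₃ ∷ []) (x₁ ∷ x₄ ∷ []) (σ≡ x₁ x₂ x₃ x₄) zs z))))))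
  where σ≡ : ∀ x₁ x₂ x₃ x₄ → x₁ + (x₂ + (x₃ + (x₄ + 0))) ≡ (x₂ + (x₃ + 0)) + (x₁ + (x₄ + 0))
        σ≡ = ℕSolver.solve-∀
proper⇒piece {x₁ = x₁} {x₂} {x₃} {x₄} _ zs (_ ∷ʳ (refl ∷ (_ ∷ʳ (refl ∷ [])))) _ _ z =
  inj₂ (inj₂ (inj₂ (inj₂ (inj₂ (inj₁ 
    (complement (x₁ ∷ x₂ ∷ x₃ ∷ x₄ ∷ []) (x₂ ∷ x₄ ∷ []) (x₁ ∷ x₃ ∷ []) (σ≡ x₁ x₂ x₃ x₄) zs z))))))
  where σ≡ : ∀ x₁ x₂ x₃ x₄ → x₁ + (x₂ + (x₃ + (x₄ + 0))) ≡ (x₂ + (x₄ + 0)) + (x₁ + (x₃ + 0))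
        σ≡ = ℕSolver.solve-∀
proper⇒piece {x₁ = x₁} {x₂} {x₃} {x₄} _ zs (_ ∷ʳ (_ ∷ʳ (refl ∷ (refl ∷ [])))) _ _ z =
  inj₂ (inj₂ (inj₂ (inj₂ (inj₁ 
    (complement (x₁ ∷ x₂ ∷ x₃ ∷ x₄ ∷ []) (x₃ ∷ x₄ ∷ []) (x₁ ∷ x₂ ∷ []) (σ≡ x₁ x₂ x₃ x₄) zs z)))))
  where σ≡ : ∀ x₁ x₂ x₃ x₄ → x₁ + (x₂ + (x₃ + (x₄ + 0))) ≡ (x₃ + (x₄ + 0)) + (x₁ + (x₂ + 0))
        σ≡ = ℕSolver.solve-∀
proper⇒piece {x₁ = x₁} {x₂} {x₃} {x₄} _ zs (_ ∷ʳ (refl ∷ (refl ∷ (refl ∷ [])))) _ _ z =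
  inj₁ 
    (complement (x₁ ∷ x₂ ∷ x₃ ∷ x₄ ∷ []) (x₂ ∷ x₃ ∷ x₄ ∷ []) (x₁ ∷ []) (σ≡ x₁ x₂ x₃ x₄) zs z)
  where σ≡ : ∀ x₁ x₂ x₃ x₄ → x₁ + (x₂ + (x₃ + (x₄ + 0))) ≡ (x₂ + (x₃ + (x₄ + 0))) + (x₁ + 0)
        σ≡ = ℕSolver.solve-∀
proper⇒piece {x₁ = x₁} {x₂} {x₃} {x₄} _ zs (refl ∷ (_ ∷ʳ (refl ∷ (refl ∷ [])))) _ _ z =
  inj₂ (inj₁ 
    (complement (x₁ ∷ x₂ ∷ x₃ ∷ x₄ ∷ []) (x₁ ∷ x₃ ∷ x₄ ∷ []) (x₂ ∷ []) (σ≡ x₁ x₂ x₃ x₄) zs z))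
  where σ≡ : ∀ x₁ x₂ x₃ x₄ → x₁ + (x₂ + (x₃ + (x₄ + 0))) ≡ (x₁ + (x₃ + (x₄ + 0))) + (x₂ + 0)
        σ≡ = ℕSolver.solve-∀
proper⇒piece {x₁ = x₁} {x₂} {x₃} {x₄} _ zs (refl ∷ (refl ∷ (_ ∷ʳ (refl ∷ [])))) _ _ z =
  inj₂ (inj₂ (inj₁ 
    (complement (x₁ ∷ x₂ ∷ x₃ ∷ x₄ ∷ []) (x₁ ∷ x₂ ∷ x₄ ∷ []) (x₃ ∷ []) (σ≡ x₁ x₂ x₃ x₄) zs z)))
  where σ≡ : ∀ x₁ x₂ x₃ x₄ → x₁ + (x₂ + (x₃ + (x₄ + 0))) ≡ (x₁ + (x₂ + (x₄ + 0))) + (x₃ + 0)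
        σ≡ = ℕSolver.solve-∀
proper⇒piece {x₁ = x₁} {x₂} {x₃} {x₄} _ zs (refl ∷ (refl ∷ (refl ∷ (_ ∷ʳ [])))) _ _ z =
  inj₂ (inj₂ (inj₂ (inj₁ 
    (complement (x₁ ∷ x₂ ∷ x₃ ∷ x₄ ∷ []) (x₁ ∷ x₂ ∷ x₃ ∷ []) (x₄ ∷ []) (σ≡ x₁ x₂ x₃ x₄) zs z))))
  where σ≡ : ∀ x₁ x₂ x₃ x₄ → x₁ + (x₂ + (x₃ + (x₄ + 0))) ≡ (x₁ + (x₂ + (x₃ + 0))) + (x₄ + 0)
        σ≡ = ℕSolver.solve-∀

not-minimal⇒piece : ∀ {n x₁ x₂ x₃ x₄} → ZeroSum n (x₁ ∷ x₂ ∷ x₃ ∷ x₄ ∷ []) →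
  ¬ MinimalZeroSum n (x₁ ∷ x₂ ∷ x₃ ∷ x₄ ∷ []) → ZeroSumPiece n x₁ x₂ x₃ x₄
not-minimal⇒piece {n} {x₁} {x₂} {x₃} {x₄} zs ¬minimal with piece? n x₁ x₂ x₃ x₄
... | yes piece = piece
... | no ¬piece = ⊥-elim (¬minimal (zs , λ T T⊆S 0<∣T∣ ∣T∣<4 zsT →
                                            ¬piece (proper⇒piece T zs T⊆S 0<∣T∣ ∣T∣<4 zsT)))

sum-map-* : ∀ k S → sum (map (k *_) S) ≡ k * sum S
sum-map-* k []      = sym (ℕP.*-zeroʳ k)
sum-map-* k (x ∷ S) = trans (cong (λ z → k * x + z) (sum-map-* k S)) (sym (ℕP.*-distribˡ-+ k x (sum S)))

-- m divides the exponent of one of the pieces of S: 1, c, n - b, n - a, 1 + c,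
-- 1 + (n - b), 1 + (n - a).
ExponentCondition : ℕ → ℕ → ℕ → ℕ → ℕ → Set
ExponentCondition m n a b c =
  m ∣ 1 ⊎ m ∣ c ⊎ m ∣ n ∸ b ⊎ m ∣ n ∸ a ⊎ m ∣ 1 + c ⊎ m ∣ 1 + (n ∸ b) ⊎ m ∣ 1 + (n ∸ a)

-- Reducedness at a prime p, with n = p·m: pS is zero-sum but not minimal, so some
-- piece p·(e·g) of it is zero-sum; as g is a unit, n ∣ pe, i.e. m ∣ e.
reduced⇒exponent : ∀ {n p m a b c g} → Prime p → n ≡ p * m → HasOrder n g n →
  ZeroSum n (theSeq n a b c g) → Reduced n (theSeq n a b c g) → ExponentCondition m n a b c
reduced⇒exponent {n} {p} {m} {a} {b} {c} {g} p-prime n≡pm order zs reduced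
  with inverse (proj₁ order) (order⇒coprime order)
... | w , wg≈1 =
  exponent (not-minimal⇒piece pS-zero-sum (reduced p p-prime (divides m (trans n≡pm (ℕP.*-comm p m)))))
  where
  pS-zero-sum : ZeroSum n (map (p *_) (theSeq n a b c g))
  pS-zero-sum = ∣⇒≡[]0 (subst (n ∣_) (sym (sum-map-* p (theSeq n a b c g)))
                                      (ℕ∣.∣n⇒∣m*n p (≡[]0⇒∣ zs)))
  m∣ : ∀ e → n ∣ p * (e * g) → m ∣ e
  m∣ e n∣pe·g = ℕ∣.*-cancelˡ-∣ p ⦃ prime⇒nonZero p-prime ⦄ (subst (_∣ p * e) n≡pm
    (unit-cancel {n} {w} {g} (p * e) wg≈1 (≈mod-trans (≈mod-reflexive (cast p e g))
                                          (fromℕ-cong (∣⇒≡[]0 n∣pe·g)))))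
    where cast : ∀ p e g → + (p * e) ℤ.* + g ≡ + (p * (e * g))
          cast p e g = trans (sym (ℤP.pos-* (p * e) g)) (cong +_ (ℕP.*-assoc p e g))
  single : ∀ {e} → ZeroSum n (p * (e * g) ∷ []) → m ∣ e
  single {e} z = m∣ e (subst (n ∣_) (trans (ℕP.+-identityʳ _) (ℕP.+-identityʳ _)) z)
  pair : ∀ {e} → ZeroSum n (p * g ∷ p * (e * g) ∷ []) → m ∣ 1 + e
  pair {e} z = m∣ (1 + e) (subst (n ∣_) (σ≡ p e g) z)
    where σ≡ : ∀ p e g → p * g + (p * (e * g) + 0) + 0 ≡ p * ((1 + e) * g)
          σ≡ = ℕSolver.solve-∀
  exponent : ZeroSumPiece n (p * g) (p * (c * g)) (p * ((n ∸ b) * g)) (p * ((n ∸ a) * g)) →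
             ExponentCondition m n a b c
  exponent (inj₁ z) = inj₁ (m∣ 1 (subst (n ∣_) (σ≡ p g) z))
    where σ≡ : ∀ p g → p * g + 0 + 0 ≡ p * (1 * g)
          σ≡ = ℕSolver.solve-∀
  exponent (inj₂ (inj₁ z))                               = inj₂ (inj₁ (single z))
  exponent (inj₂ (inj₂ (inj₁ z)))                        = inj₂ (inj₂ (inj₁ (single z)))
  exponent (inj₂ (inj₂ (inj₂ (inj₁ z))))                 = inj₂ (inj₂ (inj₂ (inj₁ (single z))))
  exponent (inj₂ (inj₂ (inj₂ (inj₂ (inj₁ z)))))          = inj₂ (inj₂ (inj₂ (inj₂ (inj₁ (pair z)))))
  exponent (inj₂ (inj₂ (inj₂ (inj₂ (inj₂ (inj₁ z))))))   = inj₂ (inj₂ (inj₂ (inj₂ (inj₂ (inj₁ (pair z))))))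
  exponent (inj₂ (inj₂ (inj₂ (inj₂ (inj₂ (inj₂ z))))))   = inj₂ (inj₂ (inj₂ (inj₂ (inj₂ (inj₂ (pair z))))))

∣n∸x⇒∣x : ∀ {d n x} → x ≤ n → d ∣ n → d ∣ n ∸ x → d ∣ x
∣n∸x⇒∣x {d} x≤n d∣n d∣n∸x = ℕ∣.∣m+n∣m⇒∣n (subst (d ∣_) (sym (ℕP.m∸n+n≡m x≤n)) d∣n) d∣n∸x

∣1+[n∸x]⇒∣x∸1 : ∀ {d n x} → 0 < x → x ≤ n → d ∣ n → d ∣ 1 + (n ∸ x) → d ∣ x ∸ 1
∣1+[n∸x]⇒∣x∸1 {d} {n} {x} 0<x x≤n d∣n d∣1+[n∸x] =
  ℕ∣.∣m+n∣m⇒∣n (subst (d ∣_) (sym σ≡) d∣n) d∣1+[n∸x]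
  where
  σ≡ : 1 + (n ∸ x) + (x ∸ 1) ≡ n
  σ≡ = begin
    1 + (n ∸ x) + (x ∸ 1)   ≡⟨ cong (_+ (x ∸ 1)) (ℕP.+-comm 1 (n ∸ x)) ⟩
    (n ∸ x) + 1 + (x ∸ 1)   ≡⟨ ℕP.+-assoc (n ∸ x) 1 (x ∸ 1) ⟩
    (n ∸ x) + (1 + (x ∸ 1)) ≡⟨ cong (λ z → (n ∸ x) + z) (ℕP.m+[n∸m]≡n 0<x) ⟩
    (n ∸ x) + x             ≡⟨ ℕP.m∸n+n≡m x≤n ⟩
    n                       ∎
    where open ≡-Reasoning

∣1+[n∸x]∧∣x⇒∣1 : ∀ {d n x} → x ≤ n → d ∣ n → d ∣ 1 + (n ∸ x) → d ∣ x → d ∣ 1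
∣1+[n∸x]∧∣x⇒∣1 {d} {n} {x} x≤n d∣n d∣1+[n∸x] d∣x =
  ℕ∣.∣m+n∣m⇒∣n (subst (d ∣_) σ≡ (ℕ∣.∣m∣n⇒∣m+n d∣1+[n∸x] d∣x)) d∣n
  where σ≡ : 1 + (n ∸ x) + x ≡ n + 1
        σ≡ = trans (cong suc (ℕP.m∸n+n≡m x≤n)) (ℕP.+-comm 1 n)

exponent-A2 : ∀ {n a b c q₁ q₃} → Shape n a b c → Prime q₁ → q₃ ∣ n → q₁ ∣ c →
  ¬ q₃ ∣ a → ¬ q₃ ∣ b → ¬ q₃ ∣ c → ExponentCondition (q₁ * q₃) n a b c →
  q₁ * q₃ ∣ 1 + (n ∸ b) ⊎ q₁ * q₃ ∣ 1 + (n ∸ a)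
exponent-A2 {n} {a} {b} {c} {q₁} {q₃} sh q₁-prime q₃∣n q₁∣c q₃∤a q₃∤b q₃∤c = eliminate
  where
  open ShapeFacts sh
  q₁∣ : ∀ {x} → q₁ * q₃ ∣ x → q₁ ∣ x
  q₁∣ = ℕ∣.∣-trans (ℕ∣.m∣m*n q₃)
  q₃∣ : ∀ {x} → q₁ * q₃ ∣ x → q₃ ∣ x
  q₃∣ = ℕ∣.∣-trans (ℕ∣.n∣m*n q₁)
  eliminate : ExponentCondition (q₁ * q₃) n a b c → q₁ * q₃ ∣ 1 + (n ∸ b) ⊎ q₁ * q₃ ∣ 1 + (n ∸ a)
  eliminate (inj₁ d)                                     = ⊥-elim (prime∤1 q₁-prime (q₁∣ d))
  eliminate (inj₂ (inj₁ d))                              = ⊥-elim (q₃∤c (q₃∣ d))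
  eliminate (inj₂ (inj₂ (inj₁ d)))                       = ⊥-elim (q₃∤b (∣n∸x⇒∣x b≤n q₃∣n (q₃∣ d)))
  eliminate (inj₂ (inj₂ (inj₂ (inj₁ d))))                = ⊥-elim (q₃∤a (∣n∸x⇒∣x a≤n q₃∣n (q₃∣ d)))
  eliminate (inj₂ (inj₂ (inj₂ (inj₂ (inj₁ d)))))         =
    ⊥-elim (prime∤1 q₁-prime (ℕ∣.∣m+n∣m⇒∣n (subst (q₁ ∣_) (ℕP.+-comm 1 c) (q₁∣ d)) q₁∣c))
  eliminate (inj₂ (inj₂ (inj₂ (inj₂ (inj₂ (inj₁ d)))))) = inj₁ d
  eliminate (inj₂ (inj₂ (inj₂ (inj₂ (inj₂ (inj₂ d)))))) = inj₂ d

-- If moreover q₁ ∣ y, then 1 + (n - y) would give q₁ ∣ 1; so q₁q₃ ∣ 1 + (n - x),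
-- i.e. q₁q₃ ∣ x - 1.
other-exponent : ∀ {n x y q₁ q₃} → 0 < x → x ≤ n → y ≤ n → Prime q₁ → q₁ * q₃ ∣ n → q₁ ∣ y →
  q₁ * q₃ ∣ 1 + (n ∸ y) ⊎ q₁ * q₃ ∣ 1 + (n ∸ x) → q₁ * q₃ ∣ x ∸ 1
other-exponent {q₁ = q₁} {q₃} _ _ y≤n q₁-prime q₁q₃∣n q₁∣y (inj₁ d) =
  ⊥-elim (prime∤1 q₁-prime (∣1+[n∸x]∧∣x⇒∣1 y≤n (q₁∣ q₁q₃∣n) (q₁∣ d) q₁∣y))
  where q₁∣ : ∀ {x} → q₁ * q₃ ∣ x → q₁ ∣ x
        q₁∣ = ℕ∣.∣-trans (ℕ∣.m∣m*n q₃)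
other-exponent 0<x x≤n _ _ q₁q₃∣n _ (inj₂ d) = ∣1+[n∸x]⇒∣x∸1 0<x x≤n q₁q₃∣n d

-- Case (A2) after relabelling so that q₁ ∣ c; the three arrangements differ in which
-- of c, b, a is divisible by q₁q₂.  In each, reducedness at q₂ yields q₁q₃ ∣ x - 1.
module ArrangementsA2 {n a b c g q₁ q₂ q₃} (sh : Shape n a b c) (fact : Factorisation n q₁ q₂ q₃)
  (order : HasOrder n g n) (zs : ZeroSum n (theSeq n a b c g)) (reduced : Reduced n (theSeq n a b c g))
  (q₃∤a : ¬ q₃ ∣ a) (q₃∤b : ¬ q₃ ∣ b) (q₃∤c : ¬ q₃ ∣ c) where
  open ShapeFacts sh
  open Factorisation fact

  n≡q₂[q₁q₃] : n ≡ q₂ * (q₁ * q₃)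
  n≡q₂[q₁q₃] = trans n≡ (lemma q₁ q₂ q₃)
    where lemma : ∀ x y z → x * y * z ≡ y * (x * z)
          lemma = ℕSolver.solve-∀

  q₁q₃∣n : q₁ * q₃ ∣ n
  q₁q₃∣n = divides q₂ n≡q₂[q₁q₃]

  reduced-at-q₂ : q₁ ∣ c → q₁ * q₃ ∣ 1 + (n ∸ b) ⊎ q₁ * q₃ ∣ 1 + (n ∸ a)
  reduced-at-q₂ q₁∣c = exponent-A2 sh prime₁ (ℕ∣.∣-trans (ℕ∣.n∣m*n q₁) q₁q₃∣n) q₁∣c q₃∤a q₃∤b q₃∤c
                         (reduced⇒exponent {a = a} {b} {c} prime₂ n≡q₂[q₁q₃] order zs reduced)

  double-c : q₁ ∣ c → q₂ ∣ c → q₁ ∣ b → q₂ ∣ a → Certificate n a b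
  double-c q₁∣c q₂∣c q₁∣b q₂∣a = certificate-A2c sh fact
    (other-exponent 0<a a≤n b≤n prime₁ q₁q₃∣n q₁∣b (reduced-at-q₂ q₁∣c)) q₂∣a q₂∣c

  double-b : q₁ ∣ c → q₁ ∣ b → q₂ ∣ b → q₂ ∣ a → Certificate n a b
  double-b q₁∣c q₁∣b q₂∣b q₂∣a = certificate-A2ab 2≤a 0<b 2a+b≤n fact
    (other-exponent 0<a a≤n b≤n prime₁ q₁q₃∣n q₁∣b (reduced-at-q₂ q₁∣c)) q₂∣a q₂∣b

  double-a : q₁ ∣ c → q₁ ∣ a → q₂ ∣ a → q₂ ∣ b → Certificate n a b
  double-a q₁∣c q₁∣a q₂∣a q₂∣b = swap-certificate (certificate-A2ab (ℕP.≤-trans 2≤a a≤b) 0<a 2b+a≤n fact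
    (other-exponent 0<b b≤n a≤n prime₁ q₁q₃∣n q₁∣a (Sum.swap (reduced-at-q₂ q₁∣c))) q₂∣b q₂∣a)
    where 2b+a≤n : 2 * b + a ≤ n
          2b+a≤n = subst (_≤ n) (ℕP.+-comm a (2 * b)) a+2b≤n

swap-factorisation : ∀ {n q₁ q₂ q₃} → Factorisation n q₁ q₂ q₃ → Factorisation n q₂ q₁ q₃
swap-factorisation {q₁ = q₁} {q₂} {q₃} fact = record
  { prime₁ = prime₂ ; prime₂ = prime₁ ; prime₃ = prime₃
  ; q₁≢q₂ = λ e → q₁≢q₂ (sym e) ; q₁≢q₃ = q₂≢q₃ ; q₂≢q₃ = q₁≢q₃
  ; n≡ = trans n≡ (cong (_* q₃) (ℕP.*-comm q₁ q₂))
  ; 3<q₁ = 3<q₂ ; 3<q₂ = 3<q₁ ; 3<q₃ = 3<q₃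
  }
  where open Factorisation fact

Pair : ℕ → ℕ → ℕ → ℕ → Set
Pair y z u v = (y ≡ u × z ≡ v) ⊎ (y ≡ v × z ≡ u)

pair : ∀ {y z u v} → u ≢ v → u ≡ y ⊎ u ≡ z → v ≡ y ⊎ v ≡ z → Pair y z u v
pair u≢v (inj₁ u≡y) (inj₁ v≡y) = ⊥-elim (u≢v (trans u≡y (sym v≡y)))
pair _   (inj₁ u≡y) (inj₂ v≡z) = inj₁ (sym u≡y , sym v≡z)
pair _   (inj₂ u≡z) (inj₁ v≡y) = inj₂ (sym v≡y , sym u≡z)
pair u≢v (inj₂ u≡z) (inj₂ v≡z) = ⊥-elim (u≢v (trans u≡z (sym v≡z)))

decode : ∀ {x y z u v w} → u ≢ v → u ≢ w → v ≢ w → SetEq3 x y z u v w →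
  (x ≡ w × Pair y z u v) ⊎ (y ≡ w × Pair x z u v) ⊎ (z ≡ w × Pair x y u v)
decode {x} {y} {z} {u} {v} {w} u≢v u≢w v≢w (_ , ⊇) with ⊇ w (inj₂ (inj₂ refl))
... | inj₁ refl        =
  inj₁ (refl , pair u≢v (drop₁ u≢w (⊇ u (inj₁ refl))) (drop₁ v≢w (⊇ v (inj₂ (inj₁ refl)))))
  where drop₁ : ∀ {e} → e ≢ x → e ≡ x ⊎ e ≡ y ⊎ e ≡ z → e ≡ y ⊎ e ≡ z
        drop₁ e≢x (inj₁ e≡x) = ⊥-elim (e≢x e≡x)
        drop₁ _   (inj₂ e∈) = e∈
... | inj₂ (inj₁ refl) =
  inj₂ (inj₁ (refl , pair u≢v (drop₂ u≢w (⊇ u (inj₁ refl))) (drop₂ v≢w (⊇ v (inj₂ (inj₁ refl))))))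
  where drop₂ : ∀ {e} → e ≢ y → e ≡ x ⊎ e ≡ y ⊎ e ≡ z → e ≡ x ⊎ e ≡ z
        drop₂ _   (inj₁ e≡x)        = inj₁ e≡x
        drop₂ e≢y (inj₂ (inj₁ e≡y)) = ⊥-elim (e≢y e≡y)
        drop₂ _   (inj₂ (inj₂ e≡z)) = inj₂ e≡z
... | inj₂ (inj₂ refl) =
  inj₂ (inj₂ (refl , pair u≢v (drop₃ u≢w (⊇ u (inj₁ refl))) (drop₃ v≢w (⊇ v (inj₂ (inj₁ refl))))))
  where drop₃ : ∀ {e} → e ≢ z → e ≡ x ⊎ e ≡ y ⊎ e ≡ z → e ≡ x ⊎ e ≡ y
        drop₃ _   (inj₁ e≡x)        = inj₁ e≡x
        drop₃ _   (inj₂ (inj₁ e≡y)) = inj₂ e≡y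
        drop₃ e≢z (inj₂ (inj₂ e≡z)) = ⊥-elim (e≢z e≡z)

-- Case (A2): {gcd(c,n), gcd(b,n), gcd(a,n)} = {q₁, q₂, q₁q₂}.  Up to exchanging q₁ and q₂,
-- one of the three arrangements above applies.
certificate-A2 : ∀ {n a b c g q₁ q₂ q₃} → Shape n a b c → Factorisation n q₁ q₂ q₃ → HasOrder n g n →
  ZeroSum n (theSeq n a b c g) → Reduced n (theSeq n a b c g) → CaseA2 n a b c q₁ q₂ q₃ → Certificate n a b
certificate-A2 {n} {a} {b} {c} {q₁ = q₁} {q₂} {q₃} sh fact order zs reduced gcds@(gcds⊆ , _) =
  arrange (decode q₁≢q₂ (q≢q₁q₂ prime₁ prime₂) (q≢q₁q₂ prime₂ prime₁ ∘ flip-product) gcds)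
  where
  open Factorisation fact
  flip-product : q₂ ≡ q₁ * q₂ → q₂ ≡ q₂ * q₁
  flip-product e = trans e (ℕP.*-comm q₁ q₂)
  q≢q₁q₂ : ∀ {p q} → Prime p → Prime q → p ≢ p * q
  q≢q₁q₂ {p} {q} p-prime q-prime p≡pq =
    ℕP.<-irrefl p≡pq (ℕP.m<m*n p q ⦃ prime⇒nonZero p-prime ⦄ (prime>1 q-prime))
  -- q₃ divides none of a, b, c, as their gcds with n are among q₁, q₂, q₁q₂.
  q₃∤ : ∀ {x} → gcd x n ≡ q₁ ⊎ gcd x n ≡ q₂ ⊎ gcd x n ≡ q₁ * q₂ → ¬ q₃ ∣ x
  q₃∤ {x} gcd∈ q₃∣x with gcd-greatest q₃∣x (divides (q₁ * q₂) n≡) | gcd∈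
  ... | q₃∣gcd | inj₁ e = prime∤prime prime₃ prime₁ (q₁≢q₃ ∘ sym) (subst (q₃ ∣_) e q₃∣gcd)
  ... | q₃∣gcd | inj₂ (inj₁ e) = prime∤prime prime₃ prime₂ (q₂≢q₃ ∘ sym) (subst (q₃ ∣_) e q₃∣gcd)
  ... | q₃∣gcd | inj₂ (inj₂ e) =
    prime∤product prime₃ prime₁ prime₂ (q₁≢q₃ ∘ sym) (q₂≢q₃ ∘ sym) (subst (q₃ ∣_) e q₃∣gcd)
  q₃∤a : ¬ q₃ ∣ a
  q₃∤a = q₃∤ (gcds⊆ (gcd a n) (inj₂ (inj₂ refl)))
  q₃∤b : ¬ q₃ ∣ b
  q₃∤b = q₃∤ (gcds⊆ (gcd b n) (inj₂ (inj₁ refl)))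
  q₃∤c : ¬ q₃ ∣ c
  q₃∤c = q₃∤ (gcds⊆ (gcd c n) (inj₁ refl))
  module Arrangements  = ArrangementsA2 sh fact order zs reduced q₃∤a q₃∤b q₃∤c
  module Arrangements′ = ArrangementsA2 sh (swap-factorisation fact) order zs reduced q₃∤a q₃∤b q₃∤c
  q₁∣ : ∀ {x} → gcd x n ≡ q₁ * q₂ → q₁ ∣ x
  q₁∣ e = ℕ∣.∣-trans (ℕ∣.m∣m*n q₂) (gcd≡⇒∣ e)
  q₂∣ : ∀ {x} → gcd x n ≡ q₁ * q₂ → q₂ ∣ x
  q₂∣ e = ℕ∣.∣-trans (ℕ∣.n∣m*n q₁) (gcd≡⇒∣ e)
  arrange : (gcd c n ≡ q₁ * q₂ × Pair (gcd b n) (gcd a n) q₁ q₂) ⊎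
            (gcd b n ≡ q₁ * q₂ × Pair (gcd c n) (gcd a n) q₁ q₂) ⊎
            (gcd a n ≡ q₁ * q₂ × Pair (gcd c n) (gcd b n) q₁ q₂) → Certificate n a b
  arrange (inj₁ (c≡ , inj₁ (b≡ , a≡))) = Arrangements.double-c  (q₁∣ c≡) (q₂∣ c≡) (gcd≡⇒∣ b≡) (gcd≡⇒∣ a≡)
  arrange (inj₁ (c≡ , inj₂ (b≡ , a≡))) = Arrangements′.double-c (q₂∣ c≡) (q₁∣ c≡) (gcd≡⇒∣ b≡) (gcd≡⇒∣ a≡)
  arrange (inj₂ (inj₁ (b≡ , inj₁ (c≡ , a≡)))) = Arrangements.double-b  (gcd≡⇒∣ c≡) (q₁∣ b≡) (q₂∣ b≡) (gcd≡⇒∣ a≡)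
  arrange (inj₂ (inj₁ (b≡ , inj₂ (c≡ , a≡)))) = Arrangements′.double-b (gcd≡⇒∣ c≡) (q₂∣ b≡) (q₁∣ b≡) (gcd≡⇒∣ a≡)
  arrange (inj₂ (inj₂ (a≡ , inj₁ (c≡ , b≡)))) = Arrangements.double-a  (gcd≡⇒∣ c≡) (q₁∣ a≡) (q₂∣ a≡) (gcd≡⇒∣ b≡)
  arrange (inj₂ (inj₂ (a≡ , inj₂ (c≡ , b≡)))) = Arrangements′.double-a (gcd≡⇒∣ c≡) (q₂∣ a≡) (q₁∣ a≡) (gcd≡⇒∣ b≡)

factorisation : ∀ {n q₁ q₂ q₃} → gcd n 6 ≡ 1 → Prime q₁ → Prime q₂ → Prime q₃ →
                q₁ ≢ q₂ → q₁ ≢ q₃ → q₂ ≢ q₃ → n ≡ q₁ * q₂ * q₃ → Factorisation n q₁ q₂ q₃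
factorisation {n} {q₁} {q₂} {q₃} gcd≡1 prime₁ prime₂ prime₃ q₁≢q₂ q₁≢q₃ q₂≢q₃ n≡ = record
  { prime₁ = prime₁ ; prime₂ = prime₂ ; prime₃ = prime₃
  ; q₁≢q₂ = q₁≢q₂ ; q₁≢q₃ = q₁≢q₃ ; q₂≢q₃ = q₂≢q₃ ; n≡ = n≡
  ; 3<q₁ = prime∣n⇒3<p gcd≡1 prime₁ (ℕ∣.∣-trans (ℕ∣.m∣m*n q₂) q₁q₂∣n)
  ; 3<q₂ = prime∣n⇒3<p gcd≡1 prime₂ (ℕ∣.∣-trans (ℕ∣.n∣m*n q₁) q₁q₂∣n)
  ; 3<q₃ = prime∣n⇒3<p gcd≡1 prime₃ (divides (q₁ * q₂) n≡)
  }
  where q₁q₂∣n : q₁ * q₂ ∣ n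
        q₁q₂∣n = divides q₃ (trans n≡ (ℕP.*-comm (q₁ * q₂) q₃))

proposition3p1 : ∀ (n p₁ p₂ p₃ : ℕ) → Prime p₁ → Prime p₂ → Prime p₃ →
    p₁ ≢ p₂ → p₁ ≢ p₃ → p₂ ≢ p₃ → n ≡ p₁ * p₂ * p₃ →
    gcd n 6 ≡ 1 → 1000 < n →
    ∀ (g : ℕ) → HasOrder n g n →
    ∀ (a b c : ℕ) → 1 + c ≡ a + b →
    1 < c → 2 * c < n → n < 2 * (n ∸ b) → n ∸ b ≤ n ∸ a → n ∸ a < n ∸ 1 →
    MinimalZeroSum n (theSeq n a b c g) → Reduced n (theSeq n a b c g) →
    (∃[ q₁ ] ∃[ q₂ ] ∃[ q₃ ]
      (Prime q₁ × Prime q₂ × Prime q₃ × q₁ ≢ q₂ × q₁ ≢ q₃ × q₂ ≢ q₃ × n ≡ q₁ * q₂ * q₃ ×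
       (CaseA2 n a b c q₁ q₂ q₃ ⊎ CaseA3 n a b c q₁ q₂ q₃ ⊎ CaseA4 n a b c q₁ q₂ q₃))) →
    IndexOne n (theSeq n a b c g)
proposition3p1 n _ _ _ _ _ _ _ _ _ _ gcd≡1 1000<n g order a b c c≡ _ 2c<n n<2[n∸b] n∸b≤n∸a n∸a<n∸1
  (zeroSum , _) reduced (q₁ , q₂ , q₃ , prime₁ , prime₂ , prime₃ , q₁≢q₂ , q₁≢q₃ , q₂≢q₃ , n≡ , case) =
  certificate⇒indexOne 1<n order c≡ a≤n b≤n zeroSum (certificate case)
  where
  sh : Shape n a b c
  sh = shape c≡ 2c<n n<2[n∸b] n∸b≤n∸a n∸a<n∸1
  fact : Factorisation n q₁ q₂ q₃
  fact = factorisation gcd≡1 prime₁ prime₂ prime₃ q₁≢q₂ q₁≢q₃ q₂≢q₃ n≡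
  open ShapeFacts sh using (a≤n; b≤n)
  1<n : 1 < n
  1<n = ℕP.≤-trans (s≤s (s≤s z≤n)) 1000<n
  certificate : CaseA2 n a b c q₁ q₂ q₃ ⊎ CaseA3 n a b c q₁ q₂ q₃ ⊎ CaseA4 n a b c q₁ q₂ q₃ →
                Certificate n a b
  certificate (inj₁ A2)        = certificate-A2 sh fact order zeroSum reduced A2
  certificate (inj₂ (inj₁ A3)) = certificate-A3 sh fact A3
  certificate (inj₂ (inj₂ A4)) = certificate-A4 sh fact A4
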